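{- Let $q$ be a prime power with $q\equiv 5\pmod 8$ and consider the directed graph $\mathcal{J}_{\mathbb{F}_q}$ defined below. Then every connected component of $\mathcal{J}_{\mathbb{F}_q}$ (component of the underlying undirected graph) is either a single vertex, or, for some positive integer $n$, it consists of the (pairwise distinct) vertices $c_i,u_i,v_i,x_i$ ($1\le i\le n$) and $w_j$ ($1\le j\le 2n$), with exactly the following edges, where indices of $c,u,v,x$ are taken modulo $n$: the directed cycle $c_1\to c_2\to\cdots\to c_n\to c_1$; edges $c_i\to u_{i+1}$; edges $v_i\to c_i$ and $v_i\to u_i$; edges $w_i\to v_i$ and $w_{n+i}\to v_i$; and edges $w_i\to x_i$ and $w_{n+i}\to x_i$ ($1\le i\le n$). These are all the vertices and edges of such a component.
   Context: $\mathbb{F}_q$ is the finite field with $q$ elements. $\phi_q\colon \mathbb{F}_q^\times\to\{\pm1\}$ is the quadratic character: $\phi_q(a)=1$ if $a$ is a square in $\mathbb{F}_q^\times$ and $-1$ otherwise. The directed graph $\mathcal{J}_{\mathbb{F}_q}=(V,E)$ has vertex set $V=\{(a,b)\in(\mathbb{F}_q^\times)^2 : \phi_q(ab)=1,\ a\neq \pm b\}$, and for $(a,b),(c,d)\in V$ there is an edge $(a,b)\to(c,d)$ if and only if $c=\frac{a+b}{2}$ and $d^2=ab$. -}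

module Defs where

open import Level using (0ℓ)
open import Data.Nat using (ℕ; suc; _%_)
open import Data.Fin using (Fin; toℕ)
open import Data.Product using (_×_; _,_; ∃; ∃-syntax; Σ)
open import Relation.Binary.PropositionalEquality using (_≡_)
open import Relation.Nullary using (¬_)
open import Algebra.Structures using (IsCommutativeRing)
open import Function.Bundles using (_↔_)
open import Relation.Binary.Construct.Closure.ReflexiveTransitive using (Star)
open import Relation.Binary.Construct.Closure.Symmetric using (SymClosure)

record FiniteField (q : ℕ) : Set₁ where
  infixl 6 _+_
  infixl 7 _*_
  field
    F     : Set
    _+_   : F → F → F
    _*_   : F → F → F
    -_    : F → F
    0#    : F
    1#    : F
    isCommutativeRing : IsCommutativeRing _≡_ _+_ _*_ -_ 0# 1#
    0≢1   : ¬ (0# ≡ 1#)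
    inv   : ∀ (a : F) → ¬ (a ≡ 0#) → ∃[ b ] (a * b ≡ 1#)
    card  : F ↔ Fin q

module Graph {q : ℕ} (𝔽 : FiniteField q) where
  open FiniteField 𝔽

  2# : F
  2# = 1# + 1#

  IsSquare : F → Set
  IsSquare x = ∃[ s ] (s * s ≡ x)

  IsVertex : F × F → Set
  IsVertex (a , b) =
    ¬ (a ≡ 0#) × ¬ (b ≡ 0#) × IsSquare (a * b) × ¬ (a ≡ b) × ¬ (a ≡ - b)

  Edge : F × F → F × F → Set
  Edge (a , b) (c , d) =
    IsVertex (a , b) × IsVertex (c , d) × (2# * c ≡ a + b) × (d * d ≡ a * b)

  Connected : F × F → F × F → Set
  Connected = Star (SymClosure Edge)

-- Abstract vertex labels of the model component with n = suc m:
-- c i, u i, v i, x i (i : Fin n), and w i, w' i standing for w_i, w_{n+i}.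
data Label (m : ℕ) : Set where
  c u v x w w' : Fin (suc m) → Label m

-- The edges of the model component (indices mod n, 0-based).
data ModelEdge (m : ℕ) : Label m → Label m → Set where
  c→c  : ∀ {i j} → toℕ j ≡ suc (toℕ i) % suc m → ModelEdge m (c i) (c j)
  c→u  : ∀ {i j} → toℕ j ≡ suc (toℕ i) % suc m → ModelEdge m (c i) (u j)
  v→c  : ∀ {i} → ModelEdge m (v i) (c i)
  v→u  : ∀ {i} → ModelEdge m (v i) (u i)
  w→v  : ∀ {i} → ModelEdge m (w i) (v i)
  w'→v : ∀ {i} → ModelEdge m (w' i) (v i)
  w→x  : ∀ {i} → ModelEdge m (w i) (x i)
  w'→x : ∀ {i} → ModelEdge m (w' i) (x i)

-- The edges out of a vertex (a , b) go to ((a + b)/2 , ±√(ab)), and the edges into (g , h)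
-- come from (g ± e , g ∓ e) and (g ∓ e , g ± e), where e² = g² - h².  For q ≡ 5 (mod 8), -1 = i²
-- is a square but i is not, so whenever ab = ±i s² with s ≠ 0 exactly one of a, b is a square.
-- Applied to the two children (m , ±t) of a vertex, this shows that exactly one child has children
-- of its own; applied to the two ordered parent pairs of a vertex with parents, that exactly one of
-- them has parents.  Hence "the child with children" is an injective map on the vertices having
-- children, parents and grandparents, and by finiteness these vertices form cycles c₁ → ⋯ → c_n.
-- The rest of a component is forced by the same local rules: u_i = neg₂ c_i, v_i is the other
-- parent of c_i, x_i = neg₂ v_i, and w_i, w_{n+i} are the two parents of v_i, where
-- neg₂ (g , h) = (g , -h).

module Submission where

open import Level using (0ℓ)
open import Data.Bool using (Bool; true; false)
open import Data.Nat as ℕ using (ℕ; zero; suc; _∸_; _≤_; _<_; _%_; _/_; z≤n; s≤s; NonZero)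
import Data.Nat.Properties as ℕ
open import Data.Nat.DivMod using (m≡m%n+[m/n]*n; m%n<n)
open import Data.Nat.Divisibility
  using (_∣_; _∤_; divides; ∣-refl; _∣0; ∣m∣n⇒∣m+n; ∣m+n∣m⇒∣n; ∣1⇒≡1; n∣m*n; ∣⇒≤)
open import Data.Nat.Tactic.RingSolver using (solve-∀)
open import Data.Fin as Fin using (Fin; toℕ)
import Data.Fin.Properties as Fin
open import Data.List using (List; []; _∷_; length; filter; map; allFin; _++_)
open import Data.List.Properties using (filter-notAll; length-map; length-tabulate; length-++)
open import Data.List.Membership.Propositional using (_∈_; _∉_; find; lose)
open import Data.List.Membership.Propositional.Properties
  using (∈-map⁺; ∈-map⁻; ∈-allFin; ∈-filter⁺; ∈-filter⁻; ∈-++⁺ˡ; ∈-++⁺ʳ)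
import Data.List.Membership.DecPropositional as DecMembership
open import Data.List.Relation.Binary.Subset.Propositional using (_⊆_)
open import Data.List.Relation.Unary.Any as Any using (here; there; any?)
open import Data.List.Relation.Unary.All as All using ([]; _∷_)
open import Data.List.Relation.Unary.All.Properties.Core using (¬Any⇒All¬)
open import Data.List.Relation.Unary.AllPairs using ([]; _∷_)
open import Data.List.Relation.Unary.Unique.Propositional using (Unique)
import Data.List.Relation.Unary.Unique.Propositional.Properties as Unique
open import Data.Maybe using (Maybe; just; nothing)
open import Data.Product using (_×_; _,_; proj₁; proj₂; ∃; ∃-syntax; Σ; swap)
open import Data.Product.Properties using (≡-dec)
open import Data.Sum as Sum using (_⊎_; inj₁; inj₂; [_,_]′; reduce)
open import Data.Unit using (⊤)
open import Data.Empty using (⊥-elim)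
open import Function using (_∘_; Inverse; Injection; _⇔_; mk⇔; Equivalence; Injective)
open import Function.Properties.Inverse using (↔⇒↣; ↔-sym)
import Function.Endo.Propositional as Endo
open import Relation.Binary.PropositionalEquality
open import Relation.Binary.Definitions using (DecidableEquality; tri<; tri≈; tri>)
open import Relation.Binary.Construct.Closure.ReflexiveTransitive using (ε; _◅_; _◅◅_; reverse)
open import Relation.Binary.Construct.Closure.Symmetric using (SymClosure; fwd; bwd; symmetric)
open import Relation.Nullary using (¬_; Dec; yes; no; does; ¬?; contradiction; _×-dec_)
open import Relation.Nullary.Reflects using (Reflects; ofʸ; ofⁿ)
open import Relation.Nullary.Decidable using (dec-true; dec-false)
open import Relation.Unary using (Pred; Decidable; ∁)
open import Relation.Unary.Properties using (∁?)
open import Algebra.Core using (Op₁; Op₂)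
open import Algebra.Bundles using (CommutativeRing; RawRing)
open import Algebra.Structures using (IsCommutativeRing)
import Algebra.Solver.Ring
import Algebra.Solver.Ring.AlmostCommutativeRing as ACR
import Algebra.Properties.Ring as RingProperties
import Algebra.Properties.CommutativeSemigroup as CommutativeSemigroupProperties
import Algebra.Properties.Semiring.Mult.TCOptimised as Multiplication
open import Defs using (FiniteField; module Graph; Label; ModelEdge)

-- The ring solver of the standard library decides equality of normal forms
-- syntactically, so over an abstract ring its coefficients must come from a
-- ring with computable equality: here ℤ, as normalised differences a − b of naturals.
module IntegerCoefficientSolver
  {A : Set} {add mul : Op₂ A} {neg : Op₁ A} {0ᴬ 1ᴬ : A}
  (isCommutativeRing : IsCommutativeRing _≡_ add mul neg 0ᴬ 1ᴬ) where

  commutativeRing : CommutativeRing 0ℓ 0ℓ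
  commutativeRing = record { isCommutativeRing = isCommutativeRing }

  open CommutativeRing commutativeRing
    using (_+_; _*_; -_; 0#; 1#; ring; semiring; +-commutativeSemigroup; +-identityˡ; +-identityʳ; -‿inverseʳ)
  open RingProperties ring using (-0#≈0#; -‿+-comm; ⁻¹-anti-homo‿-; x[y-z]≈xy-xz; [y-z]x≈yx-zx)
  open CommutativeSemigroupProperties +-commutativeSemigroup using (interchange)
  open Multiplication semiring using (×-homo-+; ×1-homo-*) renaming (_×_ to _·_)
  open ≡-Reasoning

  private
    infixl 6 _-_
    _-_ : Op₂ A
    x - y = x + - y

    ι : ℕ → A
    ι n = n · 1#

    -‿distrib-+ : ∀ x y z w → (x + z) - (y + w) ≡ (x - y) + (z - w)
    -‿distrib-+ x y z w = trans (cong (x + z +_) (sym (-‿+-comm y w))) (interchange x z (- y) (- w))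

    -‿distrib-* : ∀ x y z w → (x * z + y * w) - (x * w + y * z) ≡ (x - y) * (z - w)
    -‿distrib-* x y z w = sym (begin
      (x - y) * (z - w)                   ≡⟨ [y-z]x≈yx-zx (z - w) x y ⟩
      x * (z - w) - y * (z - w)           ≡⟨ cong₂ _-_ (x[y-z]≈xy-xz x z w) (x[y-z]≈xy-xz y z w) ⟩
      (x * z - x * w) - (y * z - y * w)   ≡⟨ cong (x * z - x * w +_) (⁻¹-anti-homo‿- (y * z) (y * w)) ⟩
      (x * z - x * w) + (y * w - y * z)   ≡⟨ interchange (x * z) (- (x * w)) (y * w) (- (y * z)) ⟩
      (x * z + y * w) + (- (x * w) - y * z) ≡⟨ cong (x * z + y * w +_) (-‿+-comm (x * w) (y * z)) ⟩
      (x * z + y * w) - (x * w + y * z)   ∎)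

    ι-∸ : ∀ a b → ι (a ∸ b) - ι (b ∸ a) ≡ ι a - ι b
    ι-∸ zero    zero    = refl
    ι-∸ zero    (suc b) = refl
    ι-∸ (suc a) zero    = refl
    ι-∸ (suc a) (suc b) = begin
      ι (a ∸ b) - ι (b ∸ a)          ≡⟨ ι-∸ a b ⟩
      ι a - ι b                      ≡⟨ sym (+-identityˡ (ι a - ι b)) ⟩
      0# + (ι a - ι b)               ≡⟨ cong (_+ (ι a - ι b)) (sym (-‿inverseʳ 1#)) ⟩
      (1# - 1#) + (ι a - ι b)        ≡⟨ sym (-‿distrib-+ 1# 1# (ι a) (ι b)) ⟩
      (1# + ι a) - (1# + ι b)        ≡⟨ sym (cong₂ _-_ (×-homo-+ 1# 1 a) (×-homo-+ 1# 1 b)) ⟩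
      ι (suc a) - ι (suc b)          ∎

  coefficients : RawRing 0ℓ 0ℓ
  coefficients = record
    { Carrier = ℕ × ℕ
    ; _≈_     = _≡_
    ; _+_     = λ (a , b) (c , d) → normalise (a ℕ.+ c) (b ℕ.+ d)
    ; _*_     = λ (a , b) (c , d) → normalise (a ℕ.* c ℕ.+ b ℕ.* d) (a ℕ.* d ℕ.+ b ℕ.* c)
    ; -_      = λ (a , b) → (b , a)
    ; 0#      = (0 , 0)
    ; 1#      = (1 , 0)
    }
    where
    normalise : ℕ → ℕ → ℕ × ℕ
    normalise a b = (a ∸ b , b ∸ a)

  -- Defined by cases so that ⟪ 0 , 0 ⟫ and ⟪ 1 , 0 ⟫ are 0# and 1# definitionally.
  ⟪_⟫ : ℕ × ℕ → A
  ⟪ a , zero  ⟫ = ι a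
  ⟪ a , suc b ⟫ = ι a - ι (suc b)

  private
    embed-difference : ∀ a b → ⟪ a , b ⟫ ≡ ι a - ι b
    embed-difference a zero    = sym (trans (cong (ι a +_) -0#≈0#) (+-identityʳ (ι a)))
    embed-difference a (suc b) = refl

    embed-normalise : ∀ a b → ⟪ a ∸ b , b ∸ a ⟫ ≡ ι a - ι b
    embed-normalise a b = trans (embed-difference (a ∸ b) (b ∸ a)) (ι-∸ a b)

    ι-+ : ∀ a b → ι (a ℕ.+ b) ≡ ι a + ι b
    ι-+ = ×-homo-+ 1#

    open RawRing coefficients using () renaming (_+_ to _⊕_; _*_ to _⊛_; -_ to ⊝_)

    embed-+ : ∀ x y → ⟪ x ⊕ y ⟫ ≡ ⟪ x ⟫ + ⟪ y ⟫
    embed-+ (a , b) (c , d) = begin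
      ⟪ (a , b) ⊕ (c , d) ⟫         ≡⟨ embed-normalise (a ℕ.+ c) (b ℕ.+ d) ⟩
      ι (a ℕ.+ c) - ι (b ℕ.+ d)     ≡⟨ cong₂ _-_ (ι-+ a c) (ι-+ b d) ⟩
      (ι a + ι c) - (ι b + ι d)     ≡⟨ -‿distrib-+ (ι a) (ι b) (ι c) (ι d) ⟩
      (ι a - ι b) + (ι c - ι d)     ≡⟨ sym (cong₂ _+_ (embed-difference a b) (embed-difference c d)) ⟩
      ⟪ a , b ⟫ + ⟪ c , d ⟫         ∎

    embed-* : ∀ x y → ⟪ x ⊛ y ⟫ ≡ ⟪ x ⟫ * ⟪ y ⟫
    embed-* (a , b) (c , d) = begin
      ⟪ (a , b) ⊛ (c , d) ⟫                              ≡⟨ embed-normalise (a ℕ.* c ℕ.+ b ℕ.* d) (a ℕ.* d ℕ.+ b ℕ.* c) ⟩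
      ι (a ℕ.* c ℕ.+ b ℕ.* d) - ι (a ℕ.* d ℕ.+ b ℕ.* c)  ≡⟨ cong₂ _-_ (ι-+-* a c b d) (ι-+-* a d b c) ⟩
      (ι a * ι c + ι b * ι d) - (ι a * ι d + ι b * ι c) ≡⟨ -‿distrib-* (ι a) (ι b) (ι c) (ι d) ⟩
      (ι a - ι b) * (ι c - ι d)                          ≡⟨ sym (cong₂ _*_ (embed-difference a b) (embed-difference c d)) ⟩
      ⟪ a , b ⟫ * ⟪ c , d ⟫                              ∎
      where
      ι-+-* : ∀ m n k l → ι (m ℕ.* n ℕ.+ k ℕ.* l) ≡ ι m * ι n + ι k * ι l
      ι-+-* m n k l = trans (ι-+ (m ℕ.* n) (k ℕ.* l)) (cong₂ _+_ (×1-homo-* m n) (×1-homo-* k l))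

    embed-neg : ∀ x → ⟪ ⊝ x ⟫ ≡ - ⟪ x ⟫
    embed-neg (a , b) = begin
      ⟪ b , a ⟫     ≡⟨ embed-difference b a ⟩
      ι b - ι a     ≡⟨ sym (⁻¹-anti-homo‿- (ι a) (ι b)) ⟩
      - (ι a - ι b) ≡⟨ cong -_ (sym (embed-difference a b)) ⟩
      - ⟪ a , b ⟫   ∎

  homomorphism : coefficients ACR.-Raw-AlmostCommutative⟶ ACR.fromCommutativeRing commutativeRing
  homomorphism = record
    { ⟦_⟧    = ⟪_⟫
    ; +-homo = embed-+
    ; *-homo = embed-*
    ; -‿homo = embed-neg
    ; 0-homo = refl
    ; 1-homo = refl
    }

  private
    coefficient-≟ : (x y : ℕ × ℕ) → Maybe (⟪ x ⟫ ≡ ⟪ y ⟫)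
    coefficient-≟ x y with ≡-dec ℕ._≟_ ℕ._≟_ x y
    ... | yes x≡y = just (cong ⟪_⟫ x≡y)
    ... | no _    = nothing

  open Algebra.Solver.Ring coefficients (ACR.fromCommutativeRing commutativeRing) homomorphism coefficient-≟ public
    using (solve; _:+_; _:*_; :-_; _:=_; con)

module Counting {A : Set} (_≟_ : DecidableEquality A) where

  open DecMembership _≟_ using (_∈?_)

  length-filter-∁ : ∀ {P : Pred A 0ℓ} (P? : Decidable P) xs →
                    length (filter P? xs) ℕ.+ length (filter (∁? P?) xs) ≡ length xs
  length-filter-∁ P? []       = refl
  length-filter-∁ P? (a ∷ xs) with P? a
  ... | yes _ = cong suc (length-filter-∁ P? xs)
  ... | no  _ = trans (ℕ.+-suc _ _) (cong suc (length-filter-∁ P? xs))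

  Unique-⊆⇒length-≤ : ∀ {xs ys} → Unique xs → xs ⊆ ys → length xs ≤ length ys
  Unique-⊆⇒length-≤ {[]}     _            _     = z≤n
  Unique-⊆⇒length-≤ {a ∷ xs} {ys} (a∉xs ∷ xs!) xs⊆ys =
    ℕ.≤-trans (s≤s (Unique-⊆⇒length-≤ xs! xs⊆ys-a))
              (filter-notAll ≢a? ys (Any.map (λ a≡b a≢b → a≢b a≡b) (xs⊆ys (here refl))))
    where
    ≢a? : Decidable (λ b → ¬ a ≡ b)
    ≢a? b = ¬? (a ≟ b)
    xs⊆ys-a : xs ⊆ filter ≢a? ys
    xs⊆ys-a b∈xs = ∈-filter⁺ ≢a? (xs⊆ys (there b∈xs)) (All.lookup a∉xs b∈xs)

  Unique-⊆-⊇⇒length-≡ : ∀ {xs ys} → Unique xs → Unique ys → xs ⊆ ys → ys ⊆ xs → length xs ≡ length ys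
  Unique-⊆-⊇⇒length-≡ xs! ys! xs⊆ys ys⊆xs =
    ℕ.≤-antisym (Unique-⊆⇒length-≤ xs! xs⊆ys) (Unique-⊆⇒length-≤ ys! ys⊆xs)

  length-filter-≟ : ∀ {a xs} → Unique xs → a ∈ xs → length (filter (_≟ a) xs) ≡ 1
  length-filter-≟ {a} {xs} xs! a∈xs = Unique-⊆-⊇⇒length-≡ (Unique.filter⁺ (_≟ a) xs!) ([] ∷ [])
    (λ b∈ → here (proj₂ (∈-filter⁻ (_≟ a) {xs = xs} b∈)))
    (λ { (here refl) → ∈-filter⁺ (_≟ a) a∈xs refl })

  module Orbits (k : ℕ) (G : Pred A 0ℓ) (orbit : A → List A)
    (orbit-length : ∀ a → length (orbit a) ≡ k) (a∈orbit : ∀ a → a ∈ orbit a)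
    (orbit-unique : ∀ {a} → G a → Unique (orbit a))
    (orbit-sym : ∀ {a b} → G a → b ∈ orbit a → a ∈ orbit b)
    (orbit-trans : ∀ {a b c} → G a → b ∈ orbit a → c ∈ orbit b → c ∈ orbit a) where

    orbits⇒∣length : ∀ {xs} → Unique xs → (∀ {a} → a ∈ xs → G a) →
                     (∀ {a b} → a ∈ xs → b ∈ orbit a → b ∈ xs) → k ∣ length xs
    orbits⇒∣length {xs} = go (length xs) ℕ.≤-refl
      where
      go : ∀ {xs} n → length xs ≤ n → Unique xs → (∀ {a} → a ∈ xs → G a) →
           (∀ {a b} → a ∈ xs → b ∈ orbit a → b ∈ xs) → k ∣ length xs
      go {[]}     _       _            _   _    _      = k ∣0
      go {a ∷ xs} (suc n) (s≤s |xs|≤n) xs! in-G closed =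
        subst (k ∣_) |orbit|+|rest|≡|a∷xs|
          (∣m∣n⇒∣m+n ∣-refl (go n |rest|≤n (Unique.filter⁺ out? xs!) (in-G ∘ in-list) rest-closed))
        where
        in? : Decidable (_∈ orbit a)
        in? b = b ∈? orbit a
        out? : Decidable (∁ (_∈ orbit a))
        out? = ∁? in?
        rest = filter out? (a ∷ xs)
        in-list : rest ⊆ a ∷ xs
        in-list b∈ = proj₁ (∈-filter⁻ out? b∈)
        rest-closed : ∀ {b c} → b ∈ rest → c ∈ orbit b → c ∈ rest
        rest-closed {b} b∈ c∈ = ∈-filter⁺ out? (closed (in-list b∈) c∈) c∉
          where
          c∉ : ¬ _ ∈ orbit a
          c∉ c∈orbit-a = proj₂ (∈-filter⁻ out? b∈)
            (orbit-trans (in-G (here refl)) c∈orbit-a (orbit-sym (in-G (in-list b∈)) c∈))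
        |orbit|≡k : length (filter in? (a ∷ xs)) ≡ k
        |orbit|≡k = trans (Unique-⊆-⊇⇒length-≡ (Unique.filter⁺ in? xs!) (orbit-unique (in-G (here refl)))
                             (λ b∈ → proj₂ (∈-filter⁻ in? b∈))
                             (λ b∈ → ∈-filter⁺ in? (closed (here refl) b∈) b∈))
                          (orbit-length a)
        |orbit|+|rest|≡|a∷xs| : k ℕ.+ length rest ≡ length (a ∷ xs)
        |orbit|+|rest|≡|a∷xs| = trans (cong (ℕ._+ length rest) (sym |orbit|≡k)) (length-filter-∁ in? (a ∷ xs))
        |rest|≤n : length rest ≤ n
        |rest|≤n = ℕ.≤-pred (ℕ.≤-trans (filter-notAll out? (a ∷ xs) (here (λ a∉ → a∉ (a∈orbit a)))) (s≤s |xs|≤n))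

minimal-witness : ∀ {P : ℕ → Set} → (∀ k → Dec (P k)) → ∀ {N} → P N → ∃ λ n → P n × (∀ {k} → k < n → ¬ P k)
minimal-witness P? {zero} P0 = zero , P0 , λ ()
minimal-witness {P} P? {suc N} PN with P? zero
... | yes P0 = zero , P0 , λ ()
... | no ¬P0 with minimal-witness (P? ∘ suc) PN
...   | n , Psn , below = suc n , Psn , below′
  where
  below′ : ∀ {k} → k < suc n → ¬ P k
  below′ {zero}  _         = ¬P0
  below′ {suc k} (s≤s k<n) = below k<n

Xor : Set → Set → Set
Xor A B = (A × ¬ B) ⊎ (¬ A × B)

module _ {A B : Set} where

  Xor⇒¬both : Xor A B → A → ¬ B
  Xor⇒¬both (inj₁ (_ , ¬b)) _ = ¬b
  Xor⇒¬both (inj₂ (¬a , _)) a = contradiction a ¬a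

  Xor-elimˡ : Xor A B → ¬ A → B
  Xor-elimˡ (inj₁ (a , _)) ¬a = contradiction a ¬a
  Xor-elimˡ (inj₂ (_ , b)) _  = b

  Xor-elimʳ : Xor A B → ¬ B → A
  Xor-elimʳ (inj₁ (a , _)) _  = a
  Xor-elimʳ (inj₂ (_ , b)) ¬b = contradiction b ¬b

  Xor-cong : ∀ {A′ B′ : Set} → A ⇔ A′ → B ⇔ B′ → Xor A B → Xor A′ B′
  Xor-cong A⇔A′ B⇔B′ (inj₁ (a , ¬b)) = inj₁ (Equivalence.to A⇔A′ a , ¬b ∘ Equivalence.from B⇔B′)
  Xor-cong A⇔A′ B⇔B′ (inj₂ (¬a , b)) = inj₂ (¬a ∘ Equivalence.from A⇔A′ , Equivalence.to B⇔B′ b)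

module FiniteFieldProperties {q : ℕ} (𝔽 : FiniteField q) where

  open FiniteField 𝔽
  open Graph 𝔽 using (2#; IsSquare)
  open IntegerCoefficientSolver isCommutativeRing public
  open CommutativeRing commutativeRing public
    using (+-assoc; +-comm; *-assoc; *-comm; +-identityˡ; +-identityʳ; *-identityˡ; *-identityʳ;
           -‿inverseʳ; zeroˡ; zeroʳ; ring)
  open RingProperties ring public
    using (-0#≈0#; -‿involutive; -‿injective; +-inverseˡ-unique; x∙y⁻¹≈ε⇒x≈y)
  open ≡-Reasoning

  infixl 6 _-_
  _-_ : F → F → F
  x - y = x + - y

  open Inverse card using (to; from; strictlyInverseʳ)
  open Injection (↔⇒↣ card) using () renaming (injective to to-injective)

  infix 4 _≟_
  abstract
    _≟_ : DecidableEquality F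
    a ≟ b with to a Fin.≟ to b
    ... | yes eq = yes (to-injective eq)
    ... | no  ne = no (ne ∘ cong to)

  elements : List F
  elements = map from (allFin q)

  ∈-elements : ∀ a → a ∈ elements
  ∈-elements a = subst (_∈ elements) (strictlyInverseʳ a) (∈-map⁺ from (∈-allFin (to a)))

  elements-unique : Unique elements
  elements-unique = Unique.map⁺ (Injection.injective (↔⇒↣ (↔-sym card))) (Unique.allFin⁺ q)

  length-elements : length elements ≡ q
  length-elements = trans (length-map from (allFin q)) (length-tabulate (λ i → i))

  encode : F × F → Fin (q ℕ.* q)
  encode (a , b) = Fin.combine (to a) (to b)

  encode-injective : ∀ {p p′} → encode p ≡ encode p′ → p ≡ p′
  encode-injective {a , b} {a′ , b′} eq = cong₂ _,_
    (to-injective (Fin.combine-injectiveˡ (to a) (to b) (to a′) (to b′) eq))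
    (to-injective (Fin.combine-injectiveʳ (to a) (to b) (to a′) (to b′) eq))

  open Counting _≟_ public

  abstract
    search : ∀ {P : F → Set} → Decidable P → Dec (∃ P)
    search P? with any? P? elements
    ... | yes P-some = let (a , _ , Pa) = find P-some in yes (a , Pa)
    ... | no  ¬P-any = no (λ (a , Pa) → ¬P-any (lose (∈-elements a) Pa))

  1≢0 : ¬ 1# ≡ 0#
  1≢0 = 0≢1 ∘ sym

  x-y≡0⇒x≡y : ∀ {x y} → x - y ≡ 0# → x ≡ y
  x-y≡0⇒x≡y = x∙y⁻¹≈ε⇒x≈y _ _

  x+y≡0⇒x≡-y : ∀ {x y} → x + y ≡ 0# → x ≡ - y
  x+y≡0⇒x≡-y = +-inverseˡ-unique _ _

  -‿≢0 : ∀ {x} → ¬ x ≡ 0# → ¬ - x ≡ 0#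
  -‿≢0 {x} x≢0 -x≡0 = x≢0 (-‿injective (trans -x≡0 (sym -0#≈0#)))

  x*y≡0⇒x≡0⊎y≡0 : ∀ {x y} → x * y ≡ 0# → x ≡ 0# ⊎ y ≡ 0#
  x*y≡0⇒x≡0⊎y≡0 {x} {y} xy≡0 with x ≟ 0#
  ... | yes x≡0 = inj₁ x≡0
  ... | no  x≢0 = let (x⁻¹ , xx⁻¹≡1) = inv x x≢0 in inj₂ (begin
    y              ≡⟨ solve 3 (λ x x⁻¹ y → y := (x :* y) :* x⁻¹ :+ y :* (con (1 , 0) :+ :- (x :* x⁻¹))) refl x x⁻¹ y ⟩
    (x * y) * x⁻¹ + y * (1# - x * x⁻¹) ≡⟨ cong₂ (λ s t → s * x⁻¹ + y * (1# - t)) xy≡0 xx⁻¹≡1 ⟩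
    0# * x⁻¹ + y * (1# - 1#)
      ≡⟨ solve 2 (λ x⁻¹ y → con (0 , 0) :* x⁻¹ :+ y :* (con (1 , 0) :+ :- con (1 , 0)) := con (0 , 0)) refl x⁻¹ y ⟩
    0#             ∎)

  *-≢0 : ∀ {x y} → ¬ x ≡ 0# → ¬ y ≡ 0# → ¬ x * y ≡ 0#
  *-≢0 x≢0 y≢0 xy≡0 with x*y≡0⇒x≡0⊎y≡0 xy≡0
  ... | inj₁ x≡0 = x≢0 x≡0
  ... | inj₂ y≡0 = y≢0 y≡0

  *-cancelˡ : ∀ {x y z} → ¬ x ≡ 0# → x * y ≡ x * z → y ≡ z
  *-cancelˡ {x} {y} {z} x≢0 xy≡xz with x*y≡0⇒x≡0⊎y≡0 x[y-z]≡0
    where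
    x[y-z]≡0 : x * (y - z) ≡ 0#
    x[y-z]≡0 = begin
      x * (y - z)     ≡⟨ solve 3 (λ x y z → x :* (y :+ :- z) := x :* y :+ :- (x :* z)) refl x y z ⟩
      x * y - x * z   ≡⟨ cong (_- x * z) xy≡xz ⟩
      x * z - x * z   ≡⟨ -‿inverseʳ (x * z) ⟩
      0#              ∎
  ... | inj₁ x≡0   = contradiction x≡0 x≢0
  ... | inj₂ y-z≡0 = x-y≡0⇒x≡y y-z≡0

  x²≡y²⇒x≡±y : ∀ {x y} → x * x ≡ y * y → x ≡ y ⊎ x ≡ - y
  x²≡y²⇒x≡±y {x} {y} x²≡y² with x*y≡0⇒x≡0⊎y≡0 [x-y][x+y]≡0
    where
    [x-y][x+y]≡0 : (x - y) * (x + y) ≡ 0#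
    [x-y][x+y]≡0 = begin
      (x - y) * (x + y) ≡⟨ solve 2 (λ x y → (x :+ :- y) :* (x :+ y) := x :* x :+ :- (y :* y)) refl x y ⟩
      x * x - y * y     ≡⟨ cong (_- y * y) x²≡y² ⟩
      y * y - y * y     ≡⟨ -‿inverseʳ (y * y) ⟩
      0#                ∎
  ... | inj₁ x-y≡0 = inj₁ (x-y≡0⇒x≡y x-y≡0)
  ... | inj₂ x+y≡0 = inj₂ (x+y≡0⇒x≡-y x+y≡0)

  x²≡0⇒x≡0 : ∀ {x} → x * x ≡ 0# → x ≡ 0#
  x²≡0⇒x≡0 = reduce ∘ x*y≡0⇒x≡0⊎y≡0

  x≢0⇒x²≢0 : ∀ {x} → ¬ x ≡ 0# → ¬ x * x ≡ 0#
  x≢0⇒x²≢0 x≢0 = x≢0 ∘ x²≡0⇒x≡0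

  -- 0⁻¹ is the junk value 0#.
  abstract
    _⁻¹ : F → F
    x ⁻¹ with x ≟ 0#
    ... | yes _   = 0#
    ... | no  x≢0 = proj₁ (inv x x≢0)

    x*x⁻¹≡1 : ∀ {x} → ¬ x ≡ 0# → x * x ⁻¹ ≡ 1#
    x*x⁻¹≡1 {x} x≢0 with x ≟ 0#
    ... | yes x≡0  = contradiction x≡0 x≢0
    ... | no  x≢0′ = proj₂ (inv x x≢0′)

  x⁻¹*x≡1 : ∀ {x} → ¬ x ≡ 0# → x ⁻¹ * x ≡ 1#
  x⁻¹*x≡1 {x} x≢0 = trans (*-comm (x ⁻¹) x) (x*x⁻¹≡1 x≢0)

  ⁻¹-≢0 : ∀ {x} → ¬ x ≡ 0# → ¬ x ⁻¹ ≡ 0#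
  ⁻¹-≢0 {x} x≢0 x⁻¹≡0 = 0≢1 (begin
    0#         ≡⟨ sym (zeroʳ x) ⟩
    x * 0#     ≡⟨ cong (x *_) (sym x⁻¹≡0) ⟩
    x * x ⁻¹   ≡⟨ x*x⁻¹≡1 x≢0 ⟩
    1#         ∎)

  ⁻¹-involutive : ∀ {x} → ¬ x ≡ 0# → x ⁻¹ ⁻¹ ≡ x
  ⁻¹-involutive {x} x≢0 =
    *-cancelˡ (⁻¹-≢0 x≢0) (trans (x*x⁻¹≡1 (⁻¹-≢0 x≢0)) (sym (x⁻¹*x≡1 x≢0)))

  abstract
    square? : Decidable IsSquare
    square? a = search (λ s → s * s ≟ a)

  -- √ of a nonsquare is the junk value 0#.
  abstract
    √_ : F → F
    √ a with square? a
    ... | yes (s , _) = s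
    ... | no  _       = 0#

    √-square : ∀ {a} → IsSquare a → √ a * √ a ≡ a
    √-square {a} a-square with square? a
    ... | yes (_ , s²≡a) = s²≡a
    ... | no  ¬square    = contradiction a-square ¬square

  √-≢0 : ∀ {a} → ¬ a ≡ 0# → IsSquare a → ¬ √ a ≡ 0#
  √-≢0 {a} a≢0 a-square √a≡0 = a≢0 (begin
    a          ≡⟨ sym (√-square a-square) ⟩
    √ a * √ a  ≡⟨ cong (λ t → t * t) √a≡0 ⟩
    0# * 0#    ≡⟨ zeroˡ 0# ⟩
    0#         ∎)

  square-* : ∀ {a b} → IsSquare a → IsSquare b → IsSquare (a * b)
  square-* {a} {b} (s , s²≡a) (t , t²≡b) = s * t , (begin
    (s * t) * (s * t) ≡⟨ solve 2 (λ s t → (s :* t) :* (s :* t) := (s :* s) :* (t :* t)) refl s t ⟩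
    (s * s) * (t * t) ≡⟨ cong₂ _*_ s²≡a t²≡b ⟩
    a * b             ∎)

  square-cancelʳ : ∀ {a b} → ¬ b ≡ 0# → IsSquare b → IsSquare (a * b) → IsSquare a
  square-cancelʳ {a} {b} b≢0 (t , t²≡b) (s , s²≡ab) = s * t ⁻¹ , (begin
    (s * t ⁻¹) * (s * t ⁻¹)          ≡⟨ solve 2 (λ s u → (s :* u) :* (s :* u) := (s :* s) :* (u :* u)) refl s (t ⁻¹) ⟩
    (s * s) * (t ⁻¹ * t ⁻¹)          ≡⟨ cong₂ (λ x y → x * (y ⁻¹ * y ⁻¹)) s²≡ab refl ⟩
    (a * b) * (t ⁻¹ * t ⁻¹)          ≡⟨ cong (λ y → (a * y) * (t ⁻¹ * t ⁻¹)) (sym t²≡b) ⟩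
    (a * (t * t)) * (t ⁻¹ * t ⁻¹)
      ≡⟨ solve 3 (λ a t u → (a :* (t :* t)) :* (u :* u) := a :* ((t :* u) :* (t :* u))) refl a t (t ⁻¹) ⟩
    a * ((t * t ⁻¹) * (t * t ⁻¹))    ≡⟨ cong (λ y → a * (y * y)) (x*x⁻¹≡1 t≢0) ⟩
    a * (1# * 1#)                    ≡⟨ solve 1 (λ a → a :* (con (1 , 0) :* con (1 , 0)) := a) refl a ⟩
    a                                ∎)
    where
    t≢0 : ¬ t ≡ 0#
    t≢0 t≡0 = b≢0 (trans (sym t²≡b) (trans (cong (_* t) t≡0) (zeroˡ t)))

  units : List F
  units = filter (∁? (_≟ 0#)) elements

  ∈-units : ∀ {a} → ¬ a ≡ 0# → a ∈ units
  ∈-units {a} a≢0 = ∈-filter⁺ (∁? (_≟ 0#)) (∈-elements a) a≢0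

  units⇒≢0 : ∀ {a} → a ∈ units → ¬ a ≡ 0#
  units⇒≢0 a∈ = proj₂ (∈-filter⁻ (∁? (_≟ 0#)) {xs = elements} a∈)

  units-unique : Unique units
  units-unique = Unique.filter⁺ _ elements-unique

  suc-length-units : suc (length units) ≡ q
  suc-length-units = begin
    suc (length units)
      ≡⟨ cong (ℕ._+ length units) (sym (length-filter-≟ elements-unique (∈-elements 0#))) ⟩
    length (filter (_≟ 0#) elements) ℕ.+ length units   ≡⟨ length-filter-∁ (_≟ 0#) elements ⟩
    length elements                                     ≡⟨ length-elements ⟩
    q                                                   ∎

  squares nonsquares : List F
  squares    = filter square? units
  nonsquares = filter (∁? square?) units

  ∈-squares : ∀ {a} → ¬ a ≡ 0# → IsSquare a → a ∈ squares
  ∈-squares a≢0 = ∈-filter⁺ square? (∈-units a≢0)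

  squares⇒≢0×square : ∀ {a} → a ∈ squares → ¬ a ≡ 0# × IsSquare a
  squares⇒≢0×square a∈ = let (a∈units , a-square) = ∈-filter⁻ square? {xs = units} a∈ in units⇒≢0 a∈units , a-square

  nonsquares⇒≢0×¬square : ∀ {a} → a ∈ nonsquares → ¬ a ≡ 0# × ¬ IsSquare a
  nonsquares⇒≢0×¬square a∈ =
    let (a∈units , a-nonsquare) = ∈-filter⁻ (∁? square?) {xs = units} a∈ in units⇒≢0 a∈units , a-nonsquare

  ∈-nonsquares : ∀ {a} → ¬ a ≡ 0# → ¬ IsSquare a → a ∈ nonsquares
  ∈-nonsquares a≢0 = ∈-filter⁺ (∁? square?) (∈-units a≢0)

  squares-unique : Unique squares
  squares-unique = Unique.filter⁺ square? units-unique

  -- a ↦ a + 1 pairs up the elements when 1 + 1 = 0.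
  2#≡0⇒2∣q : 2# ≡ 0# → 2 ∣ q
  2#≡0⇒2∣q 2≡0 = subst (2 ∣_) length-elements
    (orbits⇒∣length elements-unique _ (λ {_} {b} _ _ → ∈-elements b))
    where
    a+1+1≡a : ∀ a → (a + 1#) + 1# ≡ a
    a+1+1≡a a = trans (+-assoc a 1# 1#) (trans (cong (a +_) 2≡0) (+-identityʳ a))
    orbit : F → List F
    orbit a = a ∷ a + 1# ∷ []
    orbit-unique : ∀ {a} → ⊤ → Unique (orbit a)
    orbit-unique {a} _ = (a≢a+1 ∷ []) ∷ [] ∷ []
      where
      a≢a+1 : ¬ a ≡ a + 1#
      a≢a+1 a≡a+1 = 0≢1 (sym (begin
        1#                  ≡⟨ solve 2 (λ a u → u := (a :+ u) :+ :- a) refl a 1# ⟩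
        (a + 1#) - a        ≡⟨ cong (_- a) (sym a≡a+1) ⟩
        a - a               ≡⟨ -‿inverseʳ a ⟩
        0#                  ∎))
    orbit-sym : ∀ {a b} → ⊤ → b ∈ orbit a → a ∈ orbit b
    orbit-sym _ (here refl)         = here refl
    orbit-sym {a} _ (there (here refl)) = there (here (sym (a+1+1≡a a)))
    orbit-trans : ∀ {a b c} → ⊤ → b ∈ orbit a → c ∈ orbit b → c ∈ orbit a
    orbit-trans _ (here refl) c∈ = c∈
    orbit-trans _ (there (here refl)) (here refl) = there (here refl)
    orbit-trans {a} _ (there (here refl)) (there (here refl)) = here (a+1+1≡a a)
    open Orbits 2 (λ _ → ⊤) orbit (λ _ → refl) (λ _ → here refl) orbit-unique orbit-sym orbit-trans

  squares≢1 : List F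
  squares≢1 = filter (∁? (_≟ 1#)) squares

  squares≢1⇒ : ∀ {a} → a ∈ squares≢1 → ¬ a ≡ 0# × IsSquare a × ¬ a ≡ 1#
  squares≢1⇒ a∈ = let (a∈squares , a≢1) = ∈-filter⁻ (∁? (_≟ 1#)) {xs = squares} a∈
                      (a≢0 , a-square)  = squares⇒≢0×square a∈squares
                  in a≢0 , a-square , a≢1

  1+|squares≢1|≡|squares| : 1 ℕ.+ length squares≢1 ≡ length squares
  1+|squares≢1|≡|squares| =
    trans (cong (ℕ._+ length squares≢1) (sym (length-filter-≟ squares-unique (∈-squares 1≢0 (1# , *-identityˡ 1#)))))
          (length-filter-∁ (_≟ 1#) squares)

  -- Without a square root of -1, a ↦ a⁻¹ pairs up the squares other than 1.
  ¬-1-square⇒2∣|squares≢1| : ¬ IsSquare (- 1#) → 2 ∣ length squares≢1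
  ¬-1-square⇒2∣|squares≢1| ¬-1-square = orbits⇒∣length (Unique.filter⁺ _ squares-unique) (λ a∈ → a∈) closed
    where
    orbit : F → List F
    orbit a = a ∷ a ⁻¹ ∷ []
    orbit-unique : ∀ {a} → a ∈ squares≢1 → Unique (orbit a)
    orbit-unique {a} a∈ = (a≢a⁻¹ ∷ []) ∷ [] ∷ []
      where
      a≢a⁻¹ : ¬ a ≡ a ⁻¹
      a≢a⁻¹ a≡a⁻¹ with squares≢1⇒ a∈
      ... | a≢0 , a-square , a≢1 with x²≡y²⇒x≡±y (trans (cong (a *_) a≡a⁻¹) (trans (x*x⁻¹≡1 a≢0) (sym (*-identityˡ 1#))))
      ... | inj₁ a≡1  = a≢1 a≡1
      ... | inj₂ a≡-1 = ¬-1-square (subst IsSquare a≡-1 a-square)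
    closed : ∀ {a b} → a ∈ squares≢1 → b ∈ orbit a → b ∈ squares≢1
    closed a∈ (here refl) = a∈
    closed {a} a∈ (there (here refl)) with squares≢1⇒ a∈
    ... | a≢0 , a-square , a≢1 = ∈-filter⁺ (∁? (_≟ 1#)) (∈-squares (⁻¹-≢0 a≢0) a⁻¹-square) a⁻¹≢1
      where
      a⁻¹-square : IsSquare (a ⁻¹)
      a⁻¹-square = square-cancelʳ a≢0 a-square (1# , trans (*-identityˡ 1#) (sym (x⁻¹*x≡1 a≢0)))
      a⁻¹≢1 : ¬ a ⁻¹ ≡ 1#
      a⁻¹≢1 a⁻¹≡1 = a≢1 (trans (sym (*-identityʳ a)) (trans (cong (a *_) (sym a⁻¹≡1)) (x*x⁻¹≡1 a≢0)))
    orbit-sym : ∀ {a b} → a ∈ squares≢1 → b ∈ orbit a → a ∈ orbit b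
    orbit-sym _  (here refl)         = here refl
    orbit-sym a∈ (there (here refl)) = there (here (sym (⁻¹-involutive (proj₁ (squares≢1⇒ a∈)))))
    orbit-trans : ∀ {a b c} → a ∈ squares≢1 → b ∈ orbit a → c ∈ orbit b → c ∈ orbit a
    orbit-trans _  (here refl)         c∈                  = c∈
    orbit-trans _  (there (here refl)) (here refl)         = there (here refl)
    orbit-trans a∈ (there (here refl)) (there (here refl)) = here (⁻¹-involutive (proj₁ (squares≢1⇒ a∈)))
    open Orbits 2 (_∈ squares≢1) orbit (λ _ → refl) (λ _ → here refl) orbit-unique orbit-sym orbit-trans

  even-squares⇒-1-square : 2 ∣ length squares → IsSquare (- 1#)
  even-squares⇒-1-square 2∣|squares| with square? (- 1#)
  ... | yes -1-square = -1-square
  ... | no  ¬-1-square = contradiction (∣1⇒≡1 2∣1) (λ ())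
    where
    2∣1 : 2 ∣ 1
    2∣1 = ∣m+n∣m⇒∣n (subst (2 ∣_) (trans (sym 1+|squares≢1|≡|squares|) (ℕ.+-comm 1 _)) 2∣|squares|)
                    (¬-1-square⇒2∣|squares≢1| ¬-1-square)

  module OddCharacteristic (2≢0 : ¬ 2# ≡ 0#) where

    1≢-1 : ¬ 1# ≡ - 1#
    1≢-1 1≡-1 = 2≢0 (trans (cong (1# +_) 1≡-1) (-‿inverseʳ 1#))

    x≢-x : ∀ {x} → ¬ x ≡ 0# → ¬ x ≡ - x
    x≢-x {x} x≢0 x≡-x = *-≢0 x≢0 2≢0 (begin
      x * 2#   ≡⟨ solve 1 (λ x → x :* con (2 , 0) := x :+ x) refl x ⟩
      x + x    ≡⟨ cong (x +_) x≡-x ⟩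
      x - x    ≡⟨ -‿inverseʳ x ⟩
      0#       ∎)

    -- r ↦ r² maps the units other than -1 onto the squares, as (-1)² = 1².
    |squares|<|units| : length squares < length units
    |squares|<|units| = ℕ.≤-trans (s≤s (Unique-⊆⇒length-≤ squares-unique squares⊆)) |units-1|<|units|
      where
      units≢-1 = filter (∁? (_≟ - 1#)) units
      ∈-units≢-1 : ∀ {r} → ¬ r ≡ 0# → ¬ r ≡ - 1# → r * r ∈ map (λ r → r * r) units≢-1
      ∈-units≢-1 r≢0 r≢-1 = ∈-map⁺ (λ r → r * r) (∈-filter⁺ (∁? (_≟ - 1#)) (∈-units r≢0) r≢-1)
      squares⊆ : squares ⊆ map (λ r → r * r) units≢-1
      squares⊆ s∈ with squares⇒≢0×square s∈
      ... | s≢0 , r , r²≡s with r ≟ - 1#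
      ... | yes refl = subst (_∈ map (λ r → r * r) units≢-1)
                             (trans (solve 0 (con (1 , 0) :* con (1 , 0) := :- con (1 , 0) :* :- con (1 , 0)) refl) r²≡s)
                             (∈-units≢-1 1≢0 1≢-1)
      ... | no r≢-1 = subst (_∈ map (λ r → r * r) units≢-1) r²≡s (∈-units≢-1 r≢0 r≢-1)
        where
        r≢0 : ¬ r ≡ 0#
        r≢0 r≡0 = s≢0 (trans (sym r²≡s) (trans (cong (_* r) r≡0) (zeroˡ r)))
      |units-1|<|units| : suc (length (map (λ r → r * r) units≢-1)) ≤ length units
      |units-1|<|units| = ℕ.≤-reflexive (begin
        suc (length (map (λ r → r * r) units≢-1))  ≡⟨ cong suc (length-map _ units≢-1) ⟩
        1 ℕ.+ length units≢-1
          ≡⟨ cong (ℕ._+ length units≢-1) (sym (length-filter-≟ units-unique (∈-units (-‿≢0 1≢0)))) ⟩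
        length (filter (_≟ - 1#) units) ℕ.+ length units≢-1 ≡⟨ length-filter-∁ (_≟ - 1#) units ⟩
        length units                               ∎)

    nonsquare : ∃ λ n → ¬ n ≡ 0# × ¬ IsSquare n
    nonsquare with nonsquares in eq
    ... | n ∷ _ = n , nonsquares⇒≢0×¬square (subst (n ∈_) (sym eq) (here refl))
    ... | [] = contradiction |squares|<|units| (ℕ.<-irrefl (sym (begin
      length units                                ≡⟨ sym (length-filter-∁ square? units) ⟩
      length squares ℕ.+ length nonsquares        ≡⟨ cong (λ xs → length squares ℕ.+ length xs) eq ⟩
      length squares ℕ.+ 0                        ≡⟨ ℕ.+-identityʳ _ ⟩
      length squares                              ∎)))

    private
      n₀ : F
      n₀ = proj₁ nonsquare

      n₀≢0 : ¬ n₀ ≡ 0#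
      n₀≢0 = proj₁ (proj₂ nonsquare)

      n₀*squares : List F
      n₀*squares = map (n₀ *_) squares

      n₀*squares-unique : Unique n₀*squares
      n₀*squares-unique = Unique.map⁺ (*-cancelˡ n₀≢0) squares-unique

      n₀*squares⊆nonsquares : n₀*squares ⊆ nonsquares
      n₀*squares⊆nonsquares a∈ with ∈-map⁻ (n₀ *_) a∈
      ... | s , s∈ , refl = let (s≢0 , s-square) = squares⇒≢0×square s∈ in
        ∈-nonsquares (*-≢0 n₀≢0 s≢0) (λ n₀s-square → proj₂ (proj₂ nonsquare) (square-cancelʳ s≢0 s-square n₀s-square))

      |squares|≤|nonsquares| : length squares ≤ length nonsquares
      |squares|≤|nonsquares| = subst (_≤ length nonsquares) (length-map _ squares)
        (Unique-⊆⇒length-≤ n₀*squares-unique n₀*squares⊆nonsquares)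

      -- every unit is ±√(r²)
      |units|≤2|squares| : length units ≤ length squares ℕ.+ length squares
      |units|≤2|squares| = ℕ.≤-trans (Unique-⊆⇒length-≤ units-unique units⊆±√squares) (ℕ.≤-reflexive (begin
        length (map √_ squares ++ map (-_ ∘ √_) squares)        ≡⟨ length-++ (map √_ squares) ⟩
        length (map √_ squares) ℕ.+ length (map (-_ ∘ √_) squares)
          ≡⟨ cong₂ ℕ._+_ (length-map √_ squares) (length-map (-_ ∘ √_) squares) ⟩
        length squares ℕ.+ length squares                       ∎))
        where
        units⊆±√squares : units ⊆ map √_ squares ++ map (-_ ∘ √_) squares
        units⊆±√squares {r} r∈
          with x²≡y²⇒x≡±y (sym (√-square (r , refl))) | ∈-squares (x≢0⇒x²≢0 (units⇒≢0 r∈)) (r , refl)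
        ... | inj₁ r≡√r² | r²∈ = subst (_∈ _) (sym r≡√r²) (∈-++⁺ˡ (∈-map⁺ √_ r²∈))
        ... | inj₂ r≡-√r² | r²∈ = subst (_∈ _) (sym r≡-√r²) (∈-++⁺ʳ (map √_ squares) (∈-map⁺ (-_ ∘ √_) r²∈))

    length-squares : length squares ℕ.+ length squares ≡ length units
    length-squares = ℕ.≤-antisym
      (ℕ.≤-trans (ℕ.+-monoʳ-≤ (length squares) |squares|≤|nonsquares|) (ℕ.≤-reflexive (length-filter-∁ square? units)))
      |units|≤2|squares|

    length-nonsquares : length nonsquares ≡ length squares
    length-nonsquares = ℕ.+-cancelˡ-≡ (length squares) _ _ (trans (length-filter-∁ square? units) (sym length-squares))

    -- A nonsquare a with n₀a nonsquare would give |squares| + 1 ≤ |nonsquares| = |squares|.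
    n₀*nonsquare : ∀ {a} → ¬ a ≡ 0# → ¬ IsSquare a → IsSquare (n₀ * a)
    n₀*nonsquare {a} a≢0 a-nonsquare with square? (n₀ * a)
    ... | yes n₀a-square = n₀a-square
    ... | no  n₀a-nonsquare = ⊥-elim (ℕ.<-irrefl (sym length-nonsquares)
      (subst (_< length nonsquares) (length-map _ squares)
        (Unique-⊆⇒length-≤ (¬Any⇒All¬ n₀*squares a∉ ∷ n₀*squares-unique) a∷n₀*squares⊆nonsquares)))
      where
      a∉ : a ∉ n₀*squares
      a∉ a∈ with ∈-map⁻ (n₀ *_) a∈
      ... | s , s∈ , refl = n₀a-nonsquare (subst IsSquare
              (solve 2 (λ n s → (n :* n) :* s := n :* (n :* s)) refl n₀ s)
              (square-* (n₀ , refl) (proj₂ (squares⇒≢0×square s∈))))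
      a∷n₀*squares⊆nonsquares : a ∷ n₀*squares ⊆ nonsquares
      a∷n₀*squares⊆nonsquares (here refl) = ∈-nonsquares a≢0 a-nonsquare
      a∷n₀*squares⊆nonsquares (there a∈)  = n₀*squares⊆nonsquares a∈

    nonsquare*nonsquare : ∀ {a b} → ¬ a ≡ 0# → ¬ b ≡ 0# → ¬ IsSquare a → ¬ IsSquare b → IsSquare (a * b)
    nonsquare*nonsquare {a} {b} a≢0 b≢0 a-nonsquare b-nonsquare =
      square-cancelʳ (x≢0⇒x²≢0 n₀≢0) (n₀ , refl) (subst IsSquare
        (solve 3 (λ n a b → (n :* a) :* (n :* b) := (a :* b) :* (n :* n)) refl n₀ a b)
        (square-* (n₀*nonsquare a≢0 a-nonsquare) (n₀*nonsquare b≢0 b-nonsquare)))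

    nonsquare-product⇒xor : ∀ {a b} → ¬ a ≡ 0# → ¬ b ≡ 0# → ¬ IsSquare (a * b) → Xor (IsSquare a) (IsSquare b)
    nonsquare-product⇒xor {a} {b} a≢0 b≢0 ab-nonsquare with square? a | square? b
    ... | yes a-square | yes b-square = contradiction (square-* a-square b-square) ab-nonsquare
    ... | yes a-square | no  b-nonsquare = inj₁ (a-square , b-nonsquare)
    ... | no  a-nonsquare | yes b-square = inj₂ (a-nonsquare , b-square)
    ... | no  a-nonsquare | no  b-nonsquare = contradiction (nonsquare*nonsquare a≢0 b≢0 a-nonsquare b-nonsquare) ab-nonsquare

    module _ {i : F} (i²≡-1 : i * i ≡ - 1#) where

      infix 10 _⁴
      _⁴ : F → F
      x ⁴ = (x * x) * (x * x)

      fourthRoots : List F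
      fourthRoots = 1# ∷ i ∷ - 1# ∷ - i ∷ []

      private
        i≢±1 : ∀ {e} → e * e ≡ 1# → ¬ i ≡ e
        i≢±1 e²≡1 i≡e = 1≢-1 (trans (sym e²≡1) (trans (cong (λ x → x * x) (sym i≡e)) i²≡-1))

        1²≡1 : 1# * 1# ≡ 1#
        1²≡1 = *-identityˡ 1#

        [-1]²≡1 : - 1# * - 1# ≡ 1#
        [-1]²≡1 = solve 0 (:- con (1 , 0) :* :- con (1 , 0) := con (1 , 0)) refl

        i≢0 : ¬ i ≡ 0#
        i≢0 i≡0 = -‿≢0 1≢0 (trans (sym i²≡-1) (trans (cong (_* i) i≡0) (zeroˡ i)))

      fourthRoots-unique : Unique fourthRoots
      fourthRoots-unique =
          ((i≢±1 1²≡1 ∘ sym) ∷ 1≢-1 ∷ (λ 1≡-i → i≢±1 [-1]²≡1 (trans (sym (-‿involutive i)) (cong -_ (sym 1≡-i)))) ∷ [])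
        ∷ (i≢±1 [-1]²≡1 ∷ x≢-x i≢0 ∷ [])
        ∷ ((λ -1≡-i → i≢±1 1²≡1 (-‿injective (sym -1≡-i))) ∷ [])
        ∷ [] ∷ []

      ∈-fourthRoots⇒⁴≡1 : ∀ {c} → c ∈ fourthRoots → c ⁴ ≡ 1#
      ∈-fourthRoots⇒⁴≡1 (here refl) = solve 0 ((con (1 , 0) :* con (1 , 0)) :* (con (1 , 0) :* con (1 , 0)) := con (1 , 0)) refl
      ∈-fourthRoots⇒⁴≡1 (there (here refl)) = trans (cong (λ x → x * x) i²≡-1) [-1]²≡1
      ∈-fourthRoots⇒⁴≡1 (there (there (here refl))) = trans (cong (λ x → x * x) [-1]²≡1) 1²≡1
      ∈-fourthRoots⇒⁴≡1 (there (there (there (here refl)))) =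
        trans (solve 1 (λ i → (:- i :* :- i) :* (:- i :* :- i) := (i :* i) :* (i :* i)) refl i)
              (trans (cong (λ x → x * x) i²≡-1) [-1]²≡1)

      -- x⁴ - 1 = (x - 1)(x + 1)(x - i)(x + i)
      ⁴≡1⇒∈-fourthRoots : ∀ {c} → c ⁴ ≡ 1# → c ∈ fourthRoots
      ⁴≡1⇒∈-fourthRoots {c} c⁴≡1 with x*y≡0⇒x≡0⊎y≡0 {(c - 1#) * (c + 1#)} {(c - i) * (c + i)} product≡0
        where
        product≡0 : ((c - 1#) * (c + 1#)) * ((c - i) * (c + i)) ≡ 0#
        product≡0 = begin
          ((c - 1#) * (c + 1#)) * ((c - i) * (c + i))
            ≡⟨ solve 2 (λ c i → ((c :+ :- con (1 , 0)) :* (c :+ con (1 , 0))) :* ((c :+ :- i) :* (c :+ i))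
                              := (c :* c :+ :- con (1 , 0)) :* (c :* c :+ :- (i :* i))) refl c i ⟩
          (c * c - 1#) * (c * c - i * i)   ≡⟨ cong (λ x → (c * c - 1#) * (c * c - x)) i²≡-1 ⟩
          (c * c - 1#) * (c * c - - 1#)
            ≡⟨ solve 1 (λ c → (c :* c :+ :- con (1 , 0)) :* (c :* c :+ :- (:- con (1 , 0)))
                            := (c :* c) :* (c :* c) :+ :- con (1 , 0)) refl c ⟩
          c ⁴ - 1#                         ≡⟨ cong (_- 1#) c⁴≡1 ⟩
          1# - 1#                          ≡⟨ -‿inverseʳ 1# ⟩
          0#                               ∎
      ... | inj₁ [c-1][c+1]≡0 with x*y≡0⇒x≡0⊎y≡0 [c-1][c+1]≡0
      ...   | inj₁ c-1≡0 = here (x-y≡0⇒x≡y c-1≡0)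
      ...   | inj₂ c+1≡0 = there (there (here (x+y≡0⇒x≡-y c+1≡0)))
      ⁴≡1⇒∈-fourthRoots {c} c⁴≡1 | inj₂ [c-i][c+i]≡0 with x*y≡0⇒x≡0⊎y≡0 [c-i][c+i]≡0
      ...   | inj₁ c-i≡0 = there (here (x-y≡0⇒x≡y c-i≡0))
      ...   | inj₂ c+i≡0 = there (there (there (here (x+y≡0⇒x≡-y c+i≡0))))

      ⁴-* : ∀ x y → (x * y) ⁴ ≡ x ⁴ * y ⁴
      ⁴-* = solve 2 (λ x y → ((x :* y) :* (x :* y)) :* ((x :* y) :* (x :* y)) := ((x :* x) :* (x :* x)) :* ((y :* y) :* (y :* y))) refl

      fourthRoots-* : ∀ {c c′} → c ∈ fourthRoots → c′ ∈ fourthRoots → c * c′ ∈ fourthRoots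
      fourthRoots-* {c} {c′} c∈ c′∈ = ⁴≡1⇒∈-fourthRoots
        (trans (⁴-* c c′) (trans (cong₂ _*_ (∈-fourthRoots⇒⁴≡1 c∈) (∈-fourthRoots⇒⁴≡1 c′∈)) 1²≡1))

      fourthRoots-inverse : ∀ {c} → c ∈ fourthRoots → ∃ λ c′ → c′ ∈ fourthRoots × c′ * c ≡ 1#
      fourthRoots-inverse {c} c∈ = c * c * c , fourthRoots-* (fourthRoots-* c∈ c∈) c∈ ,
        trans (solve 1 (λ c → c :* c :* c :* c := (c :* c) :* (c :* c)) refl c) (∈-fourthRoots⇒⁴≡1 c∈)

      fourthRoot-≢0 : ∀ {c} → c ∈ fourthRoots → ¬ c ≡ 0#
      fourthRoot-≢0 {c} c∈ c≡0 = 0≢1 (trans (sym c⁴≡0) (∈-fourthRoots⇒⁴≡1 c∈))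
        where
        c⁴≡0 : c ⁴ ≡ 0#
        c⁴≡0 = trans (cong _⁴ c≡0) (trans (cong (_* (0# * 0#)) (zeroˡ 0#)) (zeroˡ (0# * 0#)))

      -- If i is a square, so is every fourth root of unity, and multiplication by them
      -- splits the squares into orbits of size 4.
      square-i⇒4∣|squares| : IsSquare i → 4 ∣ length squares
      square-i⇒4∣|squares| i-square = orbits⇒∣length squares-unique (proj₁ ∘ squares⇒≢0×square) closed
        where
        fourthRoot-square : ∀ {c} → c ∈ fourthRoots → IsSquare c
        fourthRoot-square (here refl) = 1# , 1²≡1
        fourthRoot-square (there (here refl)) = i-square
        fourthRoot-square (there (there (here refl))) = i , i²≡-1
        fourthRoot-square (there (there (there (here refl)))) =
          subst IsSquare (trans (cong (_* i) i²≡-1) (solve 1 (λ i → :- con (1 , 0) :* i := :- i) refl i)) (square-* (i , refl) i-square)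
        orbit : F → List F
        orbit a = map (_* a) fourthRoots
        orbit-unique : ∀ {a} → ¬ a ≡ 0# → Unique (orbit a)
        orbit-unique {a} a≢0 =
          Unique.map⁺ (λ {x} {y} xa≡ya → *-cancelˡ a≢0 (trans (*-comm a x) (trans xa≡ya (*-comm y a)))) fourthRoots-unique
        closed : ∀ {a b} → a ∈ squares → b ∈ orbit a → b ∈ squares
        closed {a} a∈ b∈ with ∈-map⁻ (_* a) b∈ | squares⇒≢0×square a∈
        ... | c , c∈ , refl | a≢0 , a-square = ∈-squares (*-≢0 (fourthRoot-≢0 c∈) a≢0) (square-* (fourthRoot-square c∈) a-square)
        orbit-sym : ∀ {a b} → ¬ a ≡ 0# → b ∈ orbit a → a ∈ orbit b
        orbit-sym {a} _ b∈ with ∈-map⁻ (_* a) b∈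
        ... | c , c∈ , refl = let (c′ , c′∈ , c′c≡1) = fourthRoots-inverse c∈ in
          subst (_∈ orbit (c * a)) (trans (sym (*-assoc c′ c a)) (trans (cong (_* a) c′c≡1) (*-identityˡ a)))
                (∈-map⁺ (_* (c * a)) c′∈)
        orbit-trans : ∀ {a b d} → ¬ a ≡ 0# → b ∈ orbit a → d ∈ orbit b → d ∈ orbit a
        orbit-trans {a} _ b∈ d∈ with ∈-map⁻ (_* a) b∈
        ... | c , c∈ , refl with ∈-map⁻ (_* (c * a)) d∈
        ...   | c′ , c′∈ , refl = subst (_∈ orbit a) (*-assoc c′ c a) (∈-map⁺ (_* a) (fourthRoots-* c′∈ c∈))
        open Orbits 4 (λ a → ¬ a ≡ 0#) orbit (λ a → length-map (_* a) fourthRoots) (λ a → here (sym (*-identityˡ a)))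
                    orbit-unique orbit-sym orbit-trans

module JGraph {q : ℕ} (𝔽 : FiniteField q)
  (2≢0 : ¬ Graph.2# 𝔽 ≡ FiniteField.0# 𝔽)
  {i : FiniteField.F 𝔽} (i²≡-1 : FiniteField._*_ 𝔽 i i ≡ FiniteField.-_ 𝔽 (FiniteField.1# 𝔽))
  (i-nonsquare : ¬ Graph.IsSquare 𝔽 i) where

  open FiniteField 𝔽 using (F; _+_; _*_; -_; 0#; 1#)
  open Graph 𝔽
  open FiniteFieldProperties 𝔽
  open OddCharacteristic 2≢0
  open ≡-Reasoning

  V : Set
  V = F × F

  square-neg : ∀ {x} → IsSquare x → IsSquare (- x)
  square-neg {x} x-square = subst IsSquare (trans (cong (_* x) i²≡-1) (solve 1 (λ x → :- con (1 , 0) :* x := :- x) refl x))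
                                   (square-* (i , refl) x-square)

  square-neg⁻ : ∀ {x} → IsSquare (- x) → IsSquare x
  square-neg⁻ {x} -x-square = subst IsSquare (-‿involutive x) (square-neg -x-square)

  i*square-nonsquare : ∀ {s} → ¬ s ≡ 0# → ¬ IsSquare (i * (s * s))
  i*square-nonsquare s≢0 = i-nonsquare ∘ square-cancelʳ (x≢0⇒x²≢0 s≢0) (_ , refl)

  square-4* : ∀ {x} → IsSquare x → IsSquare (2# * 2# * x)
  square-4* = square-* (2# , refl)

  square-4*⁻ : ∀ {x} → IsSquare (2# * 2# * x) → IsSquare x
  square-4*⁻ {x} 4x-square = square-cancelʳ (x≢0⇒x²≢0 2≢0) (2# , refl) (subst IsSquare (*-comm _ x) 4x-square)

  half : F → F
  half x = 2# ⁻¹ * x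

  2*half : ∀ x → 2# * half x ≡ x
  2*half x = trans (sym (*-assoc 2# (2# ⁻¹) x)) (trans (cong (_* x) (x*x⁻¹≡1 2≢0)) (*-identityˡ x))

  neg₂ : V → V
  neg₂ (a , b) = a , - b

  neg₂-involutive : ∀ p → neg₂ (neg₂ p) ≡ p
  neg₂-involutive (a , b) = cong (a ,_) (-‿involutive b)

  neg₂-injective : ∀ {p p′} → neg₂ p ≡ neg₂ p′ → p ≡ p′
  neg₂-injective {p} {p′} eq = trans (sym (neg₂-involutive p)) (trans (cong neg₂ eq) (neg₂-involutive p′))

  disc : V → F
  disc (g , h) = g * g - h * h

  mkVertex : ∀ {g h} → ¬ g ≡ 0# → ¬ h ≡ 0# → IsSquare (g * h) → ¬ g * g ≡ h * h → IsVertex (g , h)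
  mkVertex g≢0 h≢0 gh-square g²≢h² =
    g≢0 , h≢0 , gh-square , (g²≢h² ∘ cong (λ x → x * x)) ,
    (λ g≡-h → g²≢h² (trans (cong (λ x → x * x) g≡-h) (-x*-x≡x*x _)))
    where
    -x*-x≡x*x : ∀ x → - x * - x ≡ x * x
    -x*-x≡x*x = solve 1 (λ x → :- x :* :- x := x :* x) refl

  vertex⇒g²≢h² : ∀ {g h} → IsVertex (g , h) → ¬ g * g ≡ h * h
  vertex⇒g²≢h² (_ , _ , _ , g≢h , g≢-h) g²≡h² with x²≡y²⇒x≡±y g²≡h²
  ... | inj₁ g≡h  = g≢h g≡h
  ... | inj₂ g≡-h = g≢-h g≡-h

  vertex⇒disc≢0 : ∀ {z} → IsVertex z → ¬ disc z ≡ 0#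
  vertex⇒disc≢0 z-vertex = vertex⇒g²≢h² z-vertex ∘ x-y≡0⇒x≡y

  vertex-swap : ∀ {p} → IsVertex p → IsVertex (swap p)
  vertex-swap {a , b} (a≢0 , b≢0 , ab-square , a≢b , a≢-b) =
    b≢0 , a≢0 , subst IsSquare (*-comm a b) ab-square , (a≢b ∘ sym) ,
    (λ b≡-a → a≢-b (trans (sym (-‿involutive a)) (cong -_ (sym b≡-a))))

  vertex-≢-swap : ∀ {p} → IsVertex p → ¬ p ≡ swap p
  vertex-≢-swap (_ , _ , _ , a≢b , _) = a≢b ∘ cong proj₁

  vertex-neg₂ : ∀ {p} → IsVertex p → IsVertex (neg₂ p)
  vertex-neg₂ {g , h} p-vertex@(g≢0 , h≢0 , gh-square , _) =
    mkVertex g≢0 (-‿≢0 h≢0)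
      (subst IsSquare (solve 2 (λ g h → :- (g :* h) := g :* :- h) refl g h) (square-neg gh-square))
      (λ g²≡[-h]² → vertex⇒g²≢h² p-vertex (trans g²≡[-h]² (solve 1 (λ h → :- h :* :- h := h :* h) refl h)))

  child : V → V
  child (a , b) = half (a + b) , √ (a * b)

  HasChildren : V → Set
  HasChildren p = IsSquare (proj₁ (child p) * proj₂ (child p))

  HasChildren? : ∀ p → Dec (HasChildren p)
  HasChildren? p = square? _

  edge-source : ∀ {p y} → Edge p y → IsVertex p
  edge-source = proj₁

  edge-target : ∀ {p y} → Edge p y → IsVertex y
  edge-target = proj₁ ∘ proj₂

  edge-child : ∀ {p} → IsVertex p → HasChildren p → Edge p (child p)
  edge-child {a , b} p-vertex@(a≢0 , b≢0 , ab-square , a≢b , a≢-b) has-children =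
    p-vertex , mkVertex m≢0 t≢0 has-children m²≢t² , 2*half (a + b) , t²≡ab
    where
    m = half (a + b)
    t = √ (a * b)
    t²≡ab : t * t ≡ a * b
    t²≡ab = √-square ab-square
    m≢0 : ¬ m ≡ 0#
    m≢0 = *-≢0 (⁻¹-≢0 2≢0) (a≢-b ∘ x+y≡0⇒x≡-y)
    t≢0 : ¬ t ≡ 0#
    t≢0 = √-≢0 (*-≢0 a≢0 b≢0) ab-square
    -- (a - b)² = (a + b)² - 4ab = 4 (m² - t²)
    m²≢t² : ¬ m * m ≡ t * t
    m²≢t² m²≡t² = a≢b (x-y≡0⇒x≡y (x²≡0⇒x≡0 (begin
      (a - b) * (a - b)
        ≡⟨ solve 2 (λ a b → (a :+ :- b) :* (a :+ :- b) := (a :+ b) :* (a :+ b) :+ :- (con (2 , 0) :* con (2 , 0) :* (a :* b))) refl a b ⟩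
      (a + b) * (a + b) - 2# * 2# * (a * b)   ≡⟨ cong₂ (λ x y → x * x - 2# * 2# * y) (sym (2*half (a + b))) (sym t²≡ab) ⟩
      (2# * m) * (2# * m) - 2# * 2# * (t * t)
        ≡⟨ solve 3 (λ d m t → (d :* m) :* (d :* m) :+ :- (d :* d :* (t :* t)) := d :* d :* (m :* m :+ :- (t :* t))) refl 2# m t ⟩
      2# * 2# * (m * m - t * t)               ≡⟨ cong (λ x → 2# * 2# * (x - t * t)) m²≡t² ⟩
      2# * 2# * (t * t - t * t)               ≡⟨ cong (2# * 2# *_) (-‿inverseʳ (t * t)) ⟩
      2# * 2# * 0#                            ≡⟨ zeroʳ _ ⟩
      0#                                      ∎)))

  edge-neg₂ : ∀ {p y} → Edge p y → Edge p (neg₂ y)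
  edge-neg₂ {y = g , h} (p-vertex , y-vertex , 2g≡a+b , h²≡ab) =
    p-vertex , vertex-neg₂ y-vertex , 2g≡a+b , trans (solve 1 (λ h → :- h :* :- h := h :* h) refl h) h²≡ab

  edge-swap : ∀ {p y} → Edge p y → Edge (swap p) y
  edge-swap {a , b} (p-vertex , y-vertex , 2g≡a+b , h²≡ab) =
    vertex-swap p-vertex , y-vertex , trans 2g≡a+b (+-comm a b) , trans h²≡ab (*-comm a b)

  edge⇒child : ∀ {p y} → Edge p y → y ≡ child p ⊎ y ≡ neg₂ (child p)
  edge⇒child {a , b} {g , h} ((_ , _ , ab-square , _) , _ , 2g≡a+b , h²≡ab) =
    Sum.map (cong₂ _,_ g≡m) (cong₂ _,_ g≡m) (x²≡y²⇒x≡±y (trans h²≡ab (sym (√-square ab-square))))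
    where g≡m = *-cancelˡ 2≢0 (trans 2g≡a+b (sym (2*half (a + b))))

  vertex⇒square : ∀ {z} → IsVertex z → IsSquare (proj₁ z * proj₂ z)
  vertex⇒square = proj₁ ∘ proj₂ ∘ proj₂

  edge⇒HasChildren : ∀ {p y} → Edge p y → HasChildren p
  edge⇒HasChildren p→y with edge⇒child p→y
  ... | inj₁ refl = vertex⇒square (edge-target p→y)
  ... | inj₂ refl = vertex⇒square (subst IsVertex (neg₂-involutive _) (vertex-neg₂ (edge-target p→y)))

  HasParents : V → Set
  HasParents z = IsSquare (disc z)

  HasParents? : ∀ z → Dec (HasParents z)
  HasParents? z = square? (disc z)

  parent : V → V
  parent (g , h) = g + √ disc (g , h) , g - √ disc (g , h)

  edge⇒parent : ∀ {p z} → Edge p z → HasParents z × (p ≡ parent z ⊎ p ≡ swap (parent z))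
  edge⇒parent {a , b} {g , h} (_ , _ , 2g≡a+b , h²≡ab) =
    has-parents , from-root (x²≡y²⇒x≡±y (trans [a-g]²≡disc (sym (√-square has-parents))))
    where
    b≡2g-a : b ≡ 2# * g - a
    b≡2g-a = sym (trans (cong (_- a) 2g≡a+b) (solve 2 (λ a b → (a :+ b) :+ :- a := b) refl a b))
    [a-g]²≡disc : (a - g) * (a - g) ≡ disc (g , h)
    [a-g]²≡disc = begin
      (a - g) * (a - g)         ≡⟨ solve 2 (λ a g → (a :+ :- g) :* (a :+ :- g) := g :* g :+ :- (a :* (con (2 , 0) :* g :+ :- a))) refl a g ⟩
      g * g - a * (2# * g - a)  ≡⟨ cong (λ x → g * g - a * x) (sym b≡2g-a) ⟩
      g * g - a * b             ≡⟨ cong (λ x → g * g - x) (sym h²≡ab) ⟩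
      g * g - h * h             ∎
    has-parents : HasParents (g , h)
    has-parents = a - g , [a-g]²≡disc
    a,b≡g±d : ∀ {d} → a - g ≡ d → (a , b) ≡ (g + d , g - d)
    a,b≡g±d {d} a-g≡d = cong₂ _,_ a≡g+d (begin
      b                   ≡⟨ b≡2g-a ⟩
      2# * g - a          ≡⟨ cong (λ x → 2# * g - x) a≡g+d ⟩
      2# * g - (g + d)    ≡⟨ solve 2 (λ g d → con (2 , 0) :* g :+ :- (g :+ d) := g :+ :- d) refl g d ⟩
      g - d               ∎)
      where
      a≡g+d : a ≡ g + d
      a≡g+d = trans (solve 2 (λ a g → a := g :+ (a :+ :- g)) refl a g) (cong (g +_) a-g≡d)
    from-root : a - g ≡ √ disc (g , h) ⊎ a - g ≡ - √ disc (g , h) → (a , b) ≡ parent (g , h) ⊎ (a , b) ≡ swap (parent (g , h))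
    from-root (inj₁ a-g≡e) = inj₁ (a,b≡g±d a-g≡e)
    from-root (inj₂ a-g≡-e) = inj₂ (trans (a,b≡g±d a-g≡-e) (cong (λ x → (g - √ disc (g , h) , g + x)) (-‿involutive _)))

  edge⇒HasParents : ∀ {p z} → Edge p z → HasParents z
  edge⇒HasParents = proj₁ ∘ edge⇒parent

  edge-parent : ∀ {z} → IsVertex z → HasParents z → Edge (parent z) z
  edge-parent {g , h} z-vertex@(g≢0 , h≢0 , _) has-parents =
    parent-vertex , z-vertex , solve 2 (λ g e → con (2 , 0) :* g := (g :+ e) :+ (g :+ :- e)) refl g e , sym [g+e][g-e]≡h²
    where
    e = √ disc (g , h)
    e≢0 : ¬ e ≡ 0#
    e≢0 = √-≢0 (vertex⇒disc≢0 z-vertex) has-parents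
    [g+e][g-e]≡h² : (g + e) * (g - e) ≡ h * h
    [g+e][g-e]≡h² = begin
      (g + e) * (g - e)        ≡⟨ solve 2 (λ g e → (g :+ e) :* (g :+ :- e) := g :* g :+ :- (e :* e)) refl g e ⟩
      g * g - e * e            ≡⟨ cong (λ x → g * g - x) (√-square has-parents) ⟩
      g * g - (g * g - h * h)  ≡⟨ solve 2 (λ g h → g :* g :+ :- (g :* g :+ :- (h :* h)) := h :* h) refl g h ⟩
      h * h                    ∎
    -- (g + e)² - (g - e)² = 4ge ≠ 0
    parent-vertex : IsVertex (g + e , g - e)
    parent-vertex = mkVertex
      (λ g+e≡0 → x≢0⇒x²≢0 h≢0 (trans (sym [g+e][g-e]≡h²) (trans (cong (_* (g - e)) g+e≡0) (zeroˡ _))))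
      (λ g-e≡0 → x≢0⇒x²≢0 h≢0 (trans (sym [g+e][g-e]≡h²) (trans (cong ((g + e) *_) g-e≡0) (zeroʳ _))))
      (h , sym [g+e][g-e]≡h²)
      (λ squares≡ → *-≢0 (*-≢0 (x≢0⇒x²≢0 2≢0) g≢0) e≢0 (begin
        2# * 2# * g * e
          ≡⟨ solve 2 (λ g e → con (2 , 0) :* con (2 , 0) :* g :* e := (g :+ e) :* (g :+ e) :+ :- ((g :+ :- e) :* (g :+ :- e))) refl g e ⟩
        (g + e) * (g + e) - (g - e) * (g - e)         ≡⟨ cong (_- (g - e) * (g - e)) squares≡ ⟩
        (g - e) * (g - e) - (g - e) * (g - e)         ≡⟨ -‿inverseʳ _ ⟩
        0#                                            ∎))

  disc-neg₂ : ∀ z → disc (neg₂ z) ≡ disc z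
  disc-neg₂ (g , h) = cong (λ x → g * g - x) (solve 1 (λ h → :- h :* :- h := h :* h) refl h)

  parent-neg₂ : ∀ z → parent (neg₂ z) ≡ parent z
  parent-neg₂ (g , h) = cong (λ d → g + √ d , g - √ d) (disc-neg₂ (g , h))

  HasParents-neg₂ : ∀ {z} → HasParents z → HasParents (neg₂ z)
  HasParents-neg₂ {z} = subst IsSquare (sym (disc-neg₂ z))

  HasParents-swap : ∀ {z} → HasParents z → HasParents (swap z)
  HasParents-swap {g , h} = subst IsSquare (solve 2 (λ g h → :- (g :* g :+ :- (h :* h)) := h :* h :+ :- (g :* g)) refl g h) ∘ square-neg

  child-swap : ∀ p → child (swap p) ≡ child p
  child-swap (a , b) = cong₂ _,_ (cong half (+-comm b a)) (cong √_ (*-comm b a))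

  HasChildren-swap : ∀ {p} → HasChildren p → HasChildren (swap p)
  HasChildren-swap {p} = subst (λ y → IsSquare (proj₁ y * proj₂ y)) (sym (child-swap p))

  infix 4 _≡±_
  _≡±_ : F → F → Set
  x ≡± y = x ≡ y ⊎ x ≡ - y

  ≡±-trans-≡ : ∀ {x y w} → x ≡± y → y ≡ w → x ≡± w
  ≡±-trans-≡ x≡±y refl = x≡±y

  *-cong-≡± : ∀ {x y} k → x ≡± y → k * x ≡± k * y
  *-cong-≡± k (inj₁ refl) = inj₁ refl
  *-cong-≡± {y = y} k (inj₂ refl) = inj₂ (solve 2 (λ k y → k :* (:- y) := :- (k :* y)) refl k y)

  ≡±-nonsquare : ∀ {x y} → ¬ IsSquare y → x ≡± y → ¬ IsSquare x
  ≡±-nonsquare y-nonsquare (inj₁ refl) = y-nonsquare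
  ≡±-nonsquare y-nonsquare (inj₂ refl) = y-nonsquare ∘ square-neg⁻

  x²≡-y²⇒x≡±iy : ∀ {x y} → x * x ≡ - (y * y) → x ≡± i * y
  x²≡-y²⇒x≡±iy {x} {y} x²≡-y² = x²≡y²⇒x≡±y (begin
    x * x             ≡⟨ x²≡-y² ⟩
    - (y * y)         ≡⟨ solve 1 (λ y → :- (y :* y) := (:- con (1 , 0)) :* (y :* y)) refl y ⟩
    - 1# * (y * y)    ≡⟨ cong (_* (y * y)) (sym i²≡-1) ⟩
    (i * i) * (y * y) ≡⟨ solve 2 (λ i y → (i :* i) :* (y :* y) := (i :* y) :* (i :* y)) refl i y ⟩
    (i * y) * (i * y) ∎)

  ±i-product-nonsquare : ∀ {k x y s} → x * x ≡ - (y * y) → k * (i * y) ≡ i * (s * s) → ¬ s ≡ 0# → ¬ IsSquare (k * x)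
  ±i-product-nonsquare {k} x²≡-y² k[iy]≡is² s≢0 =
    ≡±-nonsquare (i*square-nonsquare s≢0) (≡±-trans-≡ (*-cong-≡± k (x²≡-y²⇒x≡±iy x²≡-y²)) k[iy]≡is²)

  -- The two candidate children quantities of z and neg₂ z multiply to ± i s².
  HasChildren-xor : ∀ {z} → IsVertex z → HasParents z → Xor (HasChildren z) (HasChildren (neg₂ z))
  HasChildren-xor {g , h} z-vertex@(g≢0 , h≢0 , gh-square , g≢h , g≢-h) has-parents =
    nonsquare-product⇒xor A≢0 B≢0 (subst (¬_ ∘ IsSquare) (*-assoc A (half (g - h)) t′)
      (±i-product-nonsquare t′²≡-t² base (*-≢0 (*-≢0 (⁻¹-≢0 2≢0) e≢0) t≢0)))
    where
    t  = √ (g * h)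
    t′ = √ (g * - h)
    e  = √ disc (g , h)
    A  = half (g + h) * t
    B  = half (g - h) * t′
    t≢0 : ¬ t ≡ 0#
    t≢0 = √-≢0 (*-≢0 g≢0 h≢0) gh-square
    e≢0 : ¬ e ≡ 0#
    e≢0 = √-≢0 (vertex⇒disc≢0 z-vertex) has-parents
    A≢0 : ¬ A ≡ 0#
    A≢0 = *-≢0 (*-≢0 (⁻¹-≢0 2≢0) (g≢-h ∘ x+y≡0⇒x≡-y)) t≢0
    B≢0 : ¬ B ≡ 0#
    B≢0 = *-≢0 (*-≢0 (⁻¹-≢0 2≢0) (g≢h ∘ x-y≡0⇒x≡y))
               (√-≢0 (*-≢0 g≢0 (-‿≢0 h≢0)) (vertex⇒square (vertex-neg₂ z-vertex)))
    t′²≡-t² : t′ * t′ ≡ - (t * t)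
    t′²≡-t² = begin
      t′ * t′    ≡⟨ √-square (vertex⇒square (vertex-neg₂ z-vertex)) ⟩
      g * - h    ≡⟨ solve 2 (λ g h → g :* :- h := :- (g :* h)) refl g h ⟩
      - (g * h)  ≡⟨ cong -_ (sym (√-square gh-square)) ⟩
      - (t * t)  ∎
    base : (A * half (g - h)) * (i * t) ≡ i * ((half e * t) * (half e * t))
    base = begin
      (A * half (g - h)) * (i * t)
        ≡⟨ solve 5 (λ j g h t i → ((j :* (g :+ h)) :* t :* (j :* (g :+ :- h))) :* (i :* t)
                                := i :* ((j :* j) :* ((g :* g :+ :- (h :* h)) :* (t :* t)))) refl (2# ⁻¹) g h t i ⟩
      i * ((2# ⁻¹ * 2# ⁻¹) * (disc (g , h) * (t * t)))
        ≡⟨ cong (λ x → i * ((2# ⁻¹ * 2# ⁻¹) * (x * (t * t)))) (sym (√-square has-parents)) ⟩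
      i * ((2# ⁻¹ * 2# ⁻¹) * ((e * e) * (t * t)))
        ≡⟨ cong (i *_) (solve 3 (λ j e t → (j :* j) :* ((e :* e) :* (t :* t)) := (j :* e :* t) :* (j :* e :* t)) refl (2# ⁻¹) e t) ⟩
      i * ((half e * t) * (half e * t))                 ∎

  HasParents-parent⇔ : ∀ g e → IsSquare (g * e) ⇔ HasParents (g + e , g - e)
  HasParents-parent⇔ g e = mk⇔ (subst IsSquare (sym disc≡4ge) ∘ square-4*) (square-4*⁻ ∘ subst IsSquare disc≡4ge)
    where
    disc≡4ge : disc (g + e , g - e) ≡ 2# * 2# * (g * e)
    disc≡4ge = solve 2 (λ g e → (g :+ e) :* (g :+ e) :+ :- ((g :+ :- e) :* (g :+ :- e))
                              := con (2 , 0) :* con (2 , 0) :* (g :* e)) refl g e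

  -- With e² = g² - h² and e′² = h² - g² = -e², the products g e and h e′ multiply to ± i (t e)².
  parent-HasParents-xor : ∀ {z} → IsVertex z → HasParents z → Xor (HasParents (parent z)) (HasParents (parent (swap z)))
  parent-HasParents-xor {g , h} z-vertex@(g≢0 , h≢0 , gh-square , _) has-parents =
    Xor-cong (HasParents-parent⇔ g e) (HasParents-parent⇔ h e′)
      (nonsquare-product⇒xor (*-≢0 g≢0 e≢0) (*-≢0 h≢0 e′≢0) (subst (¬_ ∘ IsSquare) (*-assoc (g * e) h e′)
        (±i-product-nonsquare e′²≡-e² base (*-≢0 t≢0 e≢0))))
    where
    t  = √ (g * h)
    e  = √ disc (g , h)
    e′ = √ disc (h , g)
    t≢0 : ¬ t ≡ 0#
    t≢0 = √-≢0 (*-≢0 g≢0 h≢0) gh-square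
    e≢0 : ¬ e ≡ 0#
    e≢0 = √-≢0 (vertex⇒disc≢0 z-vertex) has-parents
    e′≢0 : ¬ e′ ≡ 0#
    e′≢0 = √-≢0 (vertex⇒disc≢0 (vertex-swap z-vertex)) (HasParents-swap has-parents)
    e′²≡-e² : e′ * e′ ≡ - (e * e)
    e′²≡-e² = begin
      e′ * e′          ≡⟨ √-square (HasParents-swap has-parents) ⟩
      h * h - g * g    ≡⟨ solve 2 (λ g h → h :* h :+ :- (g :* g) := :- (g :* g :+ :- (h :* h))) refl g h ⟩
      - disc (g , h)   ≡⟨ cong -_ (sym (√-square has-parents)) ⟩
      - (e * e)        ∎
    base : (g * e * h) * (i * e) ≡ i * ((t * e) * (t * e))
    base = begin
      (g * e * h) * (i * e)     ≡⟨ solve 4 (λ g h i e → (g :* e :* h) :* (i :* e) := i :* ((g :* h) :* (e :* e))) refl g h i e ⟩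
      i * ((g * h) * (e * e))   ≡⟨ cong (λ x → i * (x * (e * e))) (sym (√-square gh-square)) ⟩
      i * ((t * t) * (e * e))   ≡⟨ cong (i *_) (solve 2 (λ t e → (t :* t) :* (e :* e) := (t :* e) :* (t :* e)) refl t e) ⟩
      i * ((t * e) * (t * e))   ∎

  -- The successor of a vertex with children: its unique child that has children itself.

  select : V → V
  select y with HasChildren? y
  ... | yes _ = y
  ... | no  _ = neg₂ y

  select-HasChildren : ∀ {y} → HasChildren y → select y ≡ y
  select-HasChildren {y} y-children with HasChildren? y
  ... | yes _          = refl
  ... | no  ¬y-children = contradiction y-children ¬y-children

  select-¬HasChildren : ∀ {y} → ¬ HasChildren y → select y ≡ neg₂ y
  select-¬HasChildren {y} ¬y-children with HasChildren? y
  ... | yes y-children = contradiction y-children ¬y-children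
  ... | no  _          = refl

  next : V → V
  next p = select (child p)

  next-swap : ∀ p → next (swap p) ≡ next p
  next-swap p = cong select (child-swap p)

  private
    children-xor : ∀ {p} → IsVertex p → HasChildren p → Xor (HasChildren (child p)) (HasChildren (neg₂ (child p)))
    children-xor p-vertex p-children =
      HasChildren-xor (edge-target p→child) (edge⇒HasParents p→child)
      where p→child = edge-child p-vertex p-children

  next-edge : ∀ {p} → IsVertex p → HasChildren p → Edge p (next p)
  next-edge {p} p-vertex p-children with HasChildren? (child p)
  ... | yes _ = edge-child p-vertex p-children
  ... | no  _ = edge-neg₂ (edge-child p-vertex p-children)

  next-HasChildren : ∀ {p} → IsVertex p → HasChildren p → HasChildren (next p)
  next-HasChildren {p} p-vertex p-children with HasChildren? (child p)
  ... | yes child-children  = child-children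
  ... | no  ¬child-children = Xor-elimˡ (children-xor p-vertex p-children) ¬child-children

  edge⇒≡next : ∀ {p y} → Edge p y → HasChildren y → y ≡ next p
  edge⇒≡next {p} p→y y-children with edge⇒child p→y
  ... | inj₁ refl = sym (select-HasChildren y-children)
  ... | inj₂ refl = sym (select-¬HasChildren
          (λ child-children → Xor⇒¬both (children-xor (edge-source p→y) (edge⇒HasChildren p→y)) child-children y-children))

  edge⇒≡neg₂-next : ∀ {p y} → Edge p y → ¬ HasChildren y → y ≡ neg₂ (next p)
  edge⇒≡neg₂-next {p} p→y ¬y-children with edge⇒child p→y
  ... | inj₁ refl = trans (sym (neg₂-involutive y)) (cong neg₂ (sym (select-¬HasChildren ¬y-children)))
    where y = child p
  ... | inj₂ refl = cong neg₂ (sym (select-HasChildren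
          (Xor-elimʳ (children-xor (edge-source p→y) (edge⇒HasChildren p→y)) ¬y-children)))

  edge⇒≡next⊎≡neg₂-next : ∀ {p y} → Edge p y → y ≡ next p ⊎ y ≡ neg₂ (next p)
  edge⇒≡next⊎≡neg₂-next {y = y} p→y with HasChildren? y
  ... | yes y-children  = inj₁ (edge⇒≡next p→y y-children)
  ... | no  ¬y-children = inj₂ (edge⇒≡neg₂-next p→y ¬y-children)

  edge⇒parents-agree : ∀ {p p′ z} → Edge p z → Edge p′ z → p′ ≡ p ⊎ p′ ≡ swap p
  edge⇒parents-agree {z = z} p→z p′→z = agree (proj₂ (edge⇒parent p→z)) (proj₂ (edge⇒parent p′→z))
    where
    agree : ∀ {p p′} → p ≡ parent z ⊎ p ≡ swap (parent z) → p′ ≡ parent z ⊎ p′ ≡ swap (parent z) →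
            p′ ≡ p ⊎ p′ ≡ swap p
    agree (inj₁ p≡) (inj₁ p′≡) = inj₁ (trans p′≡ (sym p≡))
    agree (inj₁ p≡) (inj₂ p′≡) = inj₂ (trans p′≡ (cong swap (sym p≡)))
    agree (inj₂ p≡) (inj₁ p′≡) = inj₂ (trans p′≡ (cong swap (sym p≡)))
    agree (inj₂ p≡) (inj₂ p′≡) = inj₁ (trans p′≡ (sym p≡))

  record OnCycle (p : V) : Set where
    field
      vertex       : IsVertex p
      children     : HasChildren p
      parents      : HasParents p
      grandparents : HasParents (parent p)

  next-OnCycle : ∀ {p} → OnCycle p → OnCycle (next p)
  next-OnCycle {p} p-cycle = record
    { vertex       = edge-target p→next
    ; children     = next-HasChildren vertex children
    ; parents      = edge⇒HasParents p→next
    ; grandparents = parent-parents (proj₂ (edge⇒parent p→next))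
    }
    where
    open OnCycle p-cycle
    p→next = next-edge vertex children
    parent-parents : p ≡ parent (next p) ⊎ p ≡ swap (parent (next p)) → HasParents (parent (next p))
    parent-parents (inj₁ p≡) = subst HasParents p≡ parents
    parent-parents (inj₂ p≡) = subst HasParents (cong swap p≡) (HasParents-swap parents)

  OnCycle-swap : ∀ {p} → OnCycle p → ¬ OnCycle (swap p)
  OnCycle-swap p-cycle swap-p-cycle =
    Xor⇒¬both (parent-HasParents-xor vertex parents) grandparents (OnCycle.grandparents swap-p-cycle)
    where open OnCycle p-cycle

  next-injective : ∀ {p p′} → OnCycle p → OnCycle p′ → next p ≡ next p′ → p ≡ p′
  next-injective {p} {p′} p-cycle p′-cycle next≡ = same-parent (edge⇒parents-agree p→next p′→next)
    where
    open OnCycle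
    p→next = next-edge (vertex p-cycle) (children p-cycle)
    p′→next = subst (Edge p′) (sym next≡) (next-edge (vertex p′-cycle) (children p′-cycle))
    same-parent : p′ ≡ p ⊎ p′ ≡ swap p → p ≡ p′
    same-parent (inj₁ p′≡p) = sym p′≡p
    same-parent (inj₂ p′≡swap) = contradiction (subst OnCycle p′≡swap p′-cycle) (OnCycle-swap p-cycle)

  -- Used to tell apart labelled vertices of different kinds; only w and w′ share a profile.
  profile : V → Bool × Bool × Bool
  profile p = does (HasChildren? p) , does (HasParents? p ×-dec HasParents? (parent p)) , does (HasParents? p)

  profile-≡ : ∀ {p a b c} → Reflects (HasChildren p) a → Reflects (HasParents p × HasParents (parent p)) b →
              Reflects (HasParents p) c → profile p ≡ (a , b , c)
  profile-≡ {p} ra rb rc = cong₂ _,_ (does-≡ (HasChildren? p) ra)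
    (cong₂ _,_ (does-≡ (HasParents? p ×-dec HasParents? (parent p)) rb) (does-≡ (HasParents? p) rc))
    where
    does-≡ : ∀ {A : Set} {b} (A? : Dec A) → Reflects A b → does A? ≡ b
    does-≡ A? (ofʸ a)  = dec-true A? a
    does-≡ A? (ofⁿ ¬a) = dec-false A? ¬a

  module Cycle (p₀ : V) (p₀-cycle : OnCycle p₀) where

    open Endo V using (_^_; ^-homo)

    cycle : ℕ → V
    cycle k = (next ^ k) p₀

    cycle-+ : ∀ a b → cycle (a ℕ.+ b) ≡ (next ^ a) (cycle b)
    cycle-+ a b = cong-app (^-homo next a b) p₀

    cycle-OnCycle : ∀ k → OnCycle (cycle k)
    cycle-OnCycle zero    = p₀-cycle
    cycle-OnCycle (suc k) = next-OnCycle (cycle-OnCycle k)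

    cycle-shift : ∀ a d → cycle a ≡ cycle (a ℕ.+ d) → cycle 0 ≡ cycle d
    cycle-shift zero    d eq = eq
    cycle-shift (suc a) d eq = cycle-shift a d (next-injective (cycle-OnCycle a) (cycle-OnCycle (a ℕ.+ d)) eq)

    private
      j≡i+suc[j∸suc-i] : ∀ {i j} → i < j → j ≡ i ℕ.+ suc (j ℕ.∸ suc i)
      j≡i+suc[j∸suc-i] {i} i<j = trans (sym (ℕ.m+[n∸m]≡n (ℕ.<⇒≤ i<j))) (cong (i ℕ.+_) (ℕ.+-∸-assoc 1 i<j))

    -- By the pigeonhole principle two of the first q² + 1 terms coincide.
    returns : ∃ λ d → cycle (suc d) ≡ cycle 0
    returns with Fin.pigeonhole (ℕ.n<1+n (q ℕ.* q)) (encode ∘ cycle ∘ toℕ)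
    ... | a , b , a<b , eq = toℕ b ℕ.∸ suc (toℕ a) , sym (cycle-shift (toℕ a) _
            (trans (encode-injective eq) (cong cycle (j≡i+suc[j∸suc-i] a<b))))

    period : ∃ λ m → cycle (suc m) ≡ cycle 0 × (∀ {k} → k < m → ¬ cycle (suc k) ≡ cycle 0)
    period = minimal-witness (λ k → ≡-dec _≟_ _≟_ (cycle (suc k)) (cycle 0)) {proj₁ returns} (proj₂ returns)

    m : ℕ
    m = proj₁ period

    n : ℕ
    n = suc m

    cycle-n : cycle n ≡ cycle 0
    cycle-n = proj₁ (proj₂ period)

    cycle-+n : ∀ k → cycle (k ℕ.+ n) ≡ cycle k
    cycle-+n k = trans (cycle-+ k n) (cong (next ^ k) cycle-n)

    cycle-+*n : ∀ a t → cycle (a ℕ.+ t ℕ.* n) ≡ cycle a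
    cycle-+*n a zero    = cong cycle (ℕ.+-identityʳ a)
    cycle-+*n a (suc t) = begin
      cycle (a ℕ.+ (n ℕ.+ t ℕ.* n))
        ≡⟨ cong cycle (trans (cong (a ℕ.+_) (ℕ.+-comm n (t ℕ.* n))) (sym (ℕ.+-assoc a (t ℕ.* n) n))) ⟩
      cycle (a ℕ.+ t ℕ.* n ℕ.+ n)      ≡⟨ cycle-+n (a ℕ.+ t ℕ.* n) ⟩
      cycle (a ℕ.+ t ℕ.* n)            ≡⟨ cycle-+*n a t ⟩
      cycle a                          ∎
      where open ≡-Reasoning

    cycle-% : ∀ k → cycle (k % n) ≡ cycle k
    cycle-% k = trans (sym (cycle-+*n (k % n) (k / n))) (cong cycle (sym (m≡m%n+[m/n]*n k n)))

    cycle-≡% : ∀ {j} k → j ≡ k % n → cycle j ≡ cycle k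
    cycle-≡% k j≡k%n = trans (cong cycle j≡k%n) (cycle-% k)

    cycle-distinct : ∀ {a b} → a < b → b < n → ¬ cycle a ≡ cycle b
    cycle-distinct {a} {b} a<b b<n eq = proj₂ (proj₂ period) {b ℕ.∸ suc a}
      (ℕ.≤-trans (ℕ.m≤n+m _ a) (subst (ℕ._≤ m) (j≡i+suc[j∸suc-i] a<b) (ℕ.≤-pred b<n)))
      (sym (cycle-shift a _ (trans eq (cong cycle (j≡i+suc[j∸suc-i] a<b)))))

    cycle-injective : ∀ {a b} → a < n → b < n → cycle a ≡ cycle b → a ≡ b
    cycle-injective {a} {b} a<n b<n eq with ℕ.<-cmp a b
    ... | tri< a<b _ _ = contradiction eq (cycle-distinct a<b b<n)
    ... | tri≈ _ a≡b _ = a≡b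
    ... | tri> _ _ b<a = contradiction (sym eq) (cycle-distinct b<a a<n)

    cycle-edge : ∀ k → Edge (cycle k) (cycle (suc k))
    cycle-edge k = next-edge (OnCycle.vertex (cycle-OnCycle k)) (OnCycle.children (cycle-OnCycle k))

    cycle-suc-+m : ∀ k → cycle (suc (k ℕ.+ m)) ≡ cycle k
    cycle-suc-+m k = trans (cong cycle (sym (ℕ.+-suc k m))) (cycle-+n k)

    cycle-index-injective : ∀ {i j : Fin n} → cycle (toℕ i) ≡ cycle (toℕ j) → i ≡ j
    cycle-index-injective {i} {j} = Fin.toℕ-injective ∘ cycle-injective (Fin.toℕ<n i) (Fin.toℕ<n j)

    _⁺ _⁻ : Fin n → Fin n
    i ⁺ = Fin.fromℕ< (m%n<n (suc (toℕ i)) n)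
    i ⁻ = Fin.fromℕ< (m%n<n (toℕ i ℕ.+ m) n)

    toℕ-⁺ : ∀ i → toℕ (i ⁺) ≡ suc (toℕ i) % n
    toℕ-⁺ i = Fin.toℕ-fromℕ< (m%n<n (suc (toℕ i)) n)

    cycle-⁺ : ∀ i → cycle (toℕ (i ⁺)) ≡ cycle (suc (toℕ i))
    cycle-⁺ i = cycle-≡% (suc (toℕ i)) (toℕ-⁺ i)

    cycle-⁻ : ∀ i → cycle (toℕ (i ⁻)) ≡ cycle (toℕ i ℕ.+ m)
    cycle-⁻ i = cycle-≡% (toℕ i ℕ.+ m) (Fin.toℕ-fromℕ< (m%n<n (toℕ i ℕ.+ m) n))

    -- feeder i is the vertex v_i: the other parent of c_i.
    feeder : Fin n → V
    feeder i = swap (cycle (toℕ i ℕ.+ m))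

    label : Label m → V
    label (Label.c i)  = cycle (toℕ i)
    label (Label.u i)  = neg₂ (cycle (toℕ i))
    label (Label.v i)  = feeder i
    label (Label.x i)  = neg₂ (feeder i)
    label (Label.w i)  = parent (feeder i)
    label (Label.w' i) = swap (parent (feeder i))

    private
      module C (k : ℕ) = OnCycle (cycle-OnCycle k)

    cycle-¬HasChildren-neg₂ : ∀ k → ¬ HasChildren (neg₂ (cycle k))
    cycle-¬HasChildren-neg₂ k = Xor⇒¬both (HasChildren-xor (C.vertex k) (C.parents k)) (C.children k)

    feeder-OnCycle-swap : ∀ i → OnCycle (swap (feeder i))
    feeder-OnCycle-swap i = cycle-OnCycle (toℕ i ℕ.+ m)

    module _ (i : Fin n) where
      private
        module S = OnCycle (feeder-OnCycle-swap i)

      feeder-vertex : IsVertex (feeder i)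
      feeder-vertex = vertex-swap S.vertex

      feeder-children : HasChildren (feeder i)
      feeder-children = HasChildren-swap S.children

      feeder-parents : HasParents (feeder i)
      feeder-parents = HasParents-swap S.parents

      feeder-¬grandparents : ¬ HasParents (parent (feeder i))
      feeder-¬grandparents = Xor⇒¬both (parent-HasParents-xor S.vertex S.parents) S.grandparents

      feeder-¬HasChildren-neg₂ : ¬ HasChildren (neg₂ (feeder i))
      feeder-¬HasChildren-neg₂ = Xor⇒¬both (HasChildren-xor feeder-vertex feeder-parents) feeder-children

      next-feeder : next (feeder i) ≡ cycle (toℕ i)
      next-feeder = trans (next-swap _) (cycle-suc-+m (toℕ i))

      feeder-edge : Edge (feeder i) (cycle (toℕ i))
      feeder-edge = subst (Edge (feeder i)) next-feeder (next-edge feeder-vertex feeder-children)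

      parent-feeder-edge : Edge (parent (feeder i)) (feeder i)
      parent-feeder-edge = edge-parent feeder-vertex feeder-parents

      next-parent-feeder : next (parent (feeder i)) ≡ feeder i
      next-parent-feeder = sym (edge⇒≡next parent-feeder-edge feeder-children)

    label-profile : Label m → Bool × Bool × Bool
    label-profile (Label.c _)  = true  , true  , true
    label-profile (Label.u _)  = false , true  , true
    label-profile (Label.v _)  = true  , false , true
    label-profile (Label.x _)  = false , false , true
    label-profile (Label.w _)  = true  , false , false
    label-profile (Label.w' _) = true  , false , false

    profile-label : ∀ l → profile (label l) ≡ label-profile l
    profile-label (Label.c i) = profile-≡ (ofʸ (C.children k)) (ofʸ (C.parents k , C.grandparents k)) (ofʸ (C.parents k))
      where k = toℕ i
    profile-label (Label.u i) = profile-≡ (ofⁿ (cycle-¬HasChildren-neg₂ k))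
      (ofʸ (HasParents-neg₂ (C.parents k) , subst HasParents (sym (parent-neg₂ (cycle k))) (C.grandparents k)))
      (ofʸ (HasParents-neg₂ (C.parents k)))
      where k = toℕ i
    profile-label (Label.v i) = profile-≡ (ofʸ (feeder-children i)) (ofⁿ (feeder-¬grandparents i ∘ proj₂)) (ofʸ (feeder-parents i))
    profile-label (Label.x i) = profile-≡ (ofⁿ (feeder-¬HasChildren-neg₂ i))
      (ofⁿ (feeder-¬grandparents i ∘ subst HasParents (parent-neg₂ (feeder i)) ∘ proj₂))
      (ofʸ (HasParents-neg₂ (feeder-parents i)))
    profile-label (Label.w i) = profile-≡ (ofʸ (edge⇒HasChildren (parent-feeder-edge i)))
      (ofⁿ (feeder-¬grandparents i ∘ proj₁)) (ofⁿ (feeder-¬grandparents i))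
    profile-label (Label.w' i) = profile-≡ (ofʸ (HasChildren-swap (edge⇒HasChildren (parent-feeder-edge i))))
      (ofⁿ (feeder-¬grandparents i ∘ HasParents-swap ∘ proj₁)) (ofⁿ (feeder-¬grandparents i ∘ HasParents-swap))

    feeder-injective : ∀ {i j} → feeder i ≡ feeder j → i ≡ j
    feeder-injective {i} {j} eq = cycle-index-injective (trans (sym (next-feeder i)) (trans (cong next eq) (next-feeder j)))

    parent-feeder-injective : ∀ {i j} → parent (feeder i) ≡ parent (feeder j) → i ≡ j
    parent-feeder-injective {i} {j} eq =
      feeder-injective (trans (sym (next-parent-feeder i)) (trans (cong next eq) (next-parent-feeder j)))

    -- Applying next, w_i = swap w_j forces i = j, and no vertex equals its swap.
    parent-feeder≢swap : ∀ {i j} → ¬ parent (feeder i) ≡ swap (parent (feeder j))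
    parent-feeder≢swap {i} {j} eq = vertex-≢-swap (edge-source (parent-feeder-edge i))
      (trans eq (cong (swap ∘ parent ∘ feeder) (sym i≡j)))
      where
      i≡j : i ≡ j
      i≡j = feeder-injective (trans (sym (next-parent-feeder i)) (trans (cong next eq) (trans (next-swap _) (next-parent-feeder j))))

    label-injective : Injective _≡_ _≡_ label
    label-injective {l} {l′} eq = go l l′ eq (trans (sym (profile-label l)) (trans (cong profile eq) (profile-label l′)))
      where
      open Label
      go : ∀ l l′ → label l ≡ label l′ → label-profile l ≡ label-profile l′ → l ≡ l′
      go (c i)  (c j)  eq _ = cong c (cycle-index-injective eq)
      go (u i)  (u j)  eq _ = cong u (cycle-index-injective (neg₂-injective eq))
      go (v i)  (v j)  eq _ = cong v (feeder-injective eq)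
      go (x i)  (x j)  eq _ = cong x (feeder-injective (neg₂-injective eq))
      go (w i)  (w j)  eq _ = cong w (parent-feeder-injective eq)
      go (w' i) (w' j) eq _ = cong w' (parent-feeder-injective (cong swap eq))
      go (w i)  (w' j) eq _ = contradiction eq (parent-feeder≢swap {i} {j})
      go (w' i) (w j)  eq _ = contradiction (sym eq) (parent-feeder≢swap {j} {i})
      go (c _) (u _) _ ()
      go (c _) (v _) _ ()
      go (c _) (x _) _ ()
      go (c _) (w _) _ ()
      go (c _) (w' _) _ ()
      go (u _) (c _) _ ()
      go (u _) (v _) _ ()
      go (u _) (x _) _ ()
      go (u _) (w _) _ ()
      go (u _) (w' _) _ ()
      go (v _) (c _) _ ()
      go (v _) (u _) _ ()
      go (v _) (x _) _ ()
      go (v _) (w _) _ ()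
      go (v _) (w' _) _ ()
      go (x _) (c _) _ ()
      go (x _) (u _) _ ()
      go (x _) (v _) _ ()
      go (x _) (w _) _ ()
      go (x _) (w' _) _ ()
      go (w _) (c _) _ ()
      go (w _) (u _) _ ()
      go (w _) (v _) _ ()
      go (w _) (x _) _ ()
      go (w' _) (c _) _ ()
      go (w' _) (u _) _ ()
      go (w' _) (v _) _ ()
      go (w' _) (x _) _ ()

    next-label-edge : ∀ {l l′} → ModelEdge m l l′ → Edge (label l) (label l′)
    next-label-edge {Label.c i} (ModelEdge.c→c eq) =
      subst (Edge (cycle (toℕ i))) (sym (cycle-≡% (suc (toℕ i)) eq)) (cycle-edge (toℕ i))
    next-label-edge {Label.c i} (ModelEdge.c→u eq) =
      subst (Edge (cycle (toℕ i))) (sym (cong neg₂ (cycle-≡% (suc (toℕ i)) eq))) (edge-neg₂ (cycle-edge (toℕ i)))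
    next-label-edge (ModelEdge.v→c {i})  = feeder-edge i
    next-label-edge (ModelEdge.v→u {i})  = edge-neg₂ (feeder-edge i)
    next-label-edge (ModelEdge.w→v {i})  = parent-feeder-edge i
    next-label-edge (ModelEdge.w'→v {i}) = edge-swap (parent-feeder-edge i)
    next-label-edge (ModelEdge.w→x {i})  = edge-neg₂ (parent-feeder-edge i)
    next-label-edge (ModelEdge.w'→x {i}) = edge-swap (edge-neg₂ (parent-feeder-edge i))

    private
      out-edge : ∀ {l y} l₊ l₋ → next (label l) ≡ label l₊ → neg₂ (label l₊) ≡ label l₋ →
                 ModelEdge m l l₊ → ModelEdge m l l₋ → Edge (label l) y → ∃ λ l′ → label l′ ≡ y × ModelEdge m l l′
      out-edge l₊ l₋ next≡ neg₂≡ l→l₊ l→l₋ l→y =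
        [ (λ y≡next → l₊ , sym (trans y≡next next≡) , l→l₊)
        , (λ y≡neg₂ → l₋ , sym (trans y≡neg₂ (trans (cong neg₂ next≡) neg₂≡)) , l→l₋)
        ]′ (edge⇒≡next⊎≡neg₂-next l→y)

      in-edge : ∀ {z y} l₁ l₂ → Edge (label l₁) z → swap (label l₁) ≡ label l₂ → Edge y z → ∃ λ l′ → label l′ ≡ y
      in-edge l₁ l₂ l₁→z swap≡ y→z = [ (λ y≡ → l₁ , sym y≡) , (λ y≡ → l₂ , sym (trans y≡ swap≡)) ]′
                                        (edge⇒parents-agree l₁→z y→z)

      edge-neg₂⁻ : ∀ {y z} → Edge y (neg₂ z) → Edge y z
      edge-neg₂⁻ {z = z} = subst (Edge _) (neg₂-involutive z) ∘ edge-neg₂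

      cycle-⁻-edge : ∀ i → Edge (cycle (toℕ (i ⁻))) (cycle (toℕ i))
      cycle-⁻-edge i = subst₂ Edge (sym (cycle-⁻ i)) (cycle-suc-+m (toℕ i)) (cycle-edge (toℕ i ℕ.+ m))

    edge-from-label : ∀ l {y} → Edge (label l) y → ∃ λ l′ → label l′ ≡ y × ModelEdge m l l′
    edge-from-label (Label.c i)  = out-edge (Label.c (i ⁺)) (Label.u (i ⁺)) (sym (cycle-⁺ i)) refl
                                            (ModelEdge.c→c (toℕ-⁺ i)) (ModelEdge.c→u (toℕ-⁺ i))
    edge-from-label (Label.u i)  = ⊥-elim ∘ cycle-¬HasChildren-neg₂ (toℕ i) ∘ edge⇒HasChildren
    edge-from-label (Label.v i)  = out-edge (Label.c i) (Label.u i) (next-feeder i) refl ModelEdge.v→c ModelEdge.v→u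
    edge-from-label (Label.x i)  = ⊥-elim ∘ feeder-¬HasChildren-neg₂ i ∘ edge⇒HasChildren
    edge-from-label (Label.w i)  = out-edge (Label.v i) (Label.x i) (next-parent-feeder i) refl ModelEdge.w→v ModelEdge.w→x
    edge-from-label (Label.w' i) = out-edge (Label.v i) (Label.x i) (trans (next-swap _) (next-parent-feeder i)) refl
                                            ModelEdge.w'→v ModelEdge.w'→x

    edge-to-label : ∀ l {y} → Edge y (label l) → ∃ λ l′ → label l′ ≡ y
    edge-to-label (Label.c i)  = in-edge (Label.c (i ⁻)) (Label.v i) (cycle-⁻-edge i) (cong swap (cycle-⁻ i))
    edge-to-label (Label.u i)  = in-edge (Label.c (i ⁻)) (Label.v i) (cycle-⁻-edge i) (cong swap (cycle-⁻ i)) ∘ edge-neg₂⁻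
    edge-to-label (Label.v i)  = in-edge (Label.w i) (Label.w' i) (parent-feeder-edge i) refl
    edge-to-label (Label.x i)  = in-edge (Label.w i) (Label.w' i) (parent-feeder-edge i) refl ∘ edge-neg₂⁻
    edge-to-label (Label.w i)  = ⊥-elim ∘ feeder-¬grandparents i ∘ edge⇒HasParents
    edge-to-label (Label.w' i) = ⊥-elim ∘ feeder-¬grandparents i ∘ HasParents-swap ∘ edge⇒HasParents

    label-edge⇔ : ∀ l l′ → Edge (label l) (label l′) ⇔ ModelEdge m l l′
    label-edge⇔ l l′ = mk⇔ model-edge next-label-edge
      where
      model-edge : Edge (label l) (label l′) → ModelEdge m l l′
      model-edge e = let (l″ , l″≡ , l→l″) = edge-from-label l e in subst (ModelEdge m l) (label-injective l″≡) l→l″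

    label-closed : ∀ {p y} → Connected p y → ∃ (λ l → label l ≡ p) → ∃ λ l → label l ≡ y
    label-closed ε                  l≡p        = l≡p
    label-closed (fwd p→z ◅ z⇝y) (l , refl) = label-closed z⇝y (let (l′ , l′≡ , _) = edge-from-label l p→z in l′ , l′≡)
    label-closed (bwd z→p ◅ z⇝y) (l , refl) = label-closed z⇝y (edge-to-label l z→p)

    private
      infixl 5 _▸_
      _▸_ : ∀ {a b y} → Connected a b → SymClosure Edge b y → Connected a y
      a⇝b ▸ b~y = a⇝b ◅◅ (b~y ◅ ε)

    cycle-connected : ∀ k → Connected (cycle 0) (cycle k)
    cycle-connected zero    = ε
    cycle-connected (suc k) = cycle-connected k ▸ fwd (cycle-edge k)

    feeder-connected : ∀ i → Connected (cycle 0) (feeder i)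
    feeder-connected i = cycle-connected (toℕ i) ▸ bwd (feeder-edge i)

    label-connected : ∀ l → Connected (cycle 0) (label l)
    label-connected (Label.c i)  = cycle-connected (toℕ i)
    label-connected (Label.u i)  = cycle-connected (toℕ (i ⁻)) ▸ fwd (edge-neg₂ (cycle-⁻-edge i))
    label-connected (Label.v i)  = feeder-connected i
    label-connected (Label.x i)  = feeder-connected i ▸ bwd (parent-feeder-edge i) ▸ fwd (edge-neg₂ (parent-feeder-edge i))
    label-connected (Label.w i)  = feeder-connected i ▸ bwd (parent-feeder-edge i)
    label-connected (Label.w' i) = feeder-connected i ▸ bwd (edge-swap (parent-feeder-edge i))

    connected⇔label : ∀ {p} → Connected p (cycle 0) → ∀ y → Connected p y ⇔ ∃ λ l → label l ≡ y
    connected⇔label p⇝c₀ y = mk⇔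
      (λ p⇝y → label-closed (reverse (symmetric Edge) p⇝c₀ ◅◅ p⇝y) (Label.c Fin.zero , refl))
      (λ (l , l≡y) → subst (Connected _) l≡y (p⇝c₀ ◅◅ label-connected l))

  Component : V → Set
  Component p = ∃[ m ] Σ (Label m → V) λ L →
                  Injective _≡_ _≡_ L
                  × (∀ y → Connected p y ⇔ (∃[ l ] (L l ≡ y)))
                  × (∀ l l′ → Edge (L l) (L l′) ⇔ ModelEdge m l l′)

  connected-to-cycle⇒Component : ∀ {p p₀} → OnCycle p₀ → Connected p p₀ → Component p
  connected-to-cycle⇒Component {p₀ = p₀} p₀-cycle p⇝p₀ = m , label , label-injective , connected⇔label p⇝p₀ , label-edge⇔
    where open Cycle p₀ p₀-cycle

  -- A vertex with children and parents lies on a cycle, or its swap does.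
  Component-via : ∀ {p y} → Connected p y → IsVertex y → HasChildren y → HasParents y → Component p
  Component-via {y = y} p⇝y y-vertex y-children y-parents with HasParents? (parent y)
  ... | yes grandparents = connected-to-cycle⇒Component y-cycle p⇝y
    where
    y-cycle : OnCycle y
    y-cycle = record { vertex = y-vertex ; children = y-children ; parents = y-parents ; grandparents = grandparents }
  ... | no ¬grandparents = connected-to-cycle⇒Component swap-y-cycle (p⇝y ◅◅ fwd y→next ◅ bwd (edge-swap y→next) ◅ ε)
    where
    y→next = next-edge y-vertex y-children
    swap-y-cycle : OnCycle (swap y)
    swap-y-cycle = record
      { vertex       = vertex-swap y-vertex
      ; children     = HasChildren-swap y-children
      ; parents      = HasParents-swap y-parents
      ; grandparents = Xor-elimˡ (parent-HasParents-xor y-vertex y-parents) ¬grandparents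
      }

  isolated : ∀ {p} → ¬ HasChildren p → ¬ HasParents p → ∀ y → Connected p y → y ≡ p
  isolated _         _        _ ε               = refl
  isolated ¬children _        _ (fwd p→z ◅ _) = contradiction (edge⇒HasChildren p→z) ¬children
  isolated _         ¬parents _ (bwd z→p ◅ _) = contradiction (edge⇒HasParents z→p) ¬parents

  isolated⊎Component : ∀ {p} → IsVertex p → (∀ y → Connected p y → y ≡ p) ⊎ Component p
  isolated⊎Component {p} p-vertex with HasChildren? p | HasParents? p
  ... | no  ¬children | no  ¬parents = inj₁ (isolated ¬children ¬parents)
  ... | yes children  | yes parents  = inj₂ (Component-via ε p-vertex children parents)
  ... | yes children  | no  _        = inj₂ (Component-via (fwd p→next ◅ ε) (edge-target p→next)
                                               (next-HasChildren p-vertex children) (edge⇒HasParents p→next))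
    where p→next = next-edge p-vertex children
  ... | no  ¬children | yes parents  = inj₂ (Component-via (bwd parent→p ◅ fwd (edge-neg₂ parent→p) ◅ ε) (vertex-neg₂ p-vertex)
                                               (Xor-elimˡ (HasChildren-xor p-vertex parents) ¬children) (HasParents-neg₂ parents))
    where parent→p = edge-parent p-vertex parents

0<r<d⇒d∤r+t*d : ∀ {r d} t → .{{NonZero r}} → r < d → d ∤ r ℕ.+ t ℕ.* d
0<r<d⇒d∤r+t*d {r} {d} t r<d d∣r+td =
  ℕ.<⇒≱ r<d (∣⇒≤ (∣m+n∣m⇒∣n (subst (d ∣_) (ℕ.+-comm r (t ℕ.* d)) d∣r+td) (n∣m*n t)))

module _ {q : ℕ} (q%8≡5 : q % 8 ≡ 5) where

  private
    t : ℕ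
    t = q / 8

    q≡5+t*8 : q ≡ 5 ℕ.+ t ℕ.* 8
    q≡5+t*8 = trans (m≡m%n+[m/n]*n q 8) (cong (ℕ._+ t ℕ.* 8) q%8≡5)

  q≡5[8]⇒2∤q : 2 ∤ q
  q≡5[8]⇒2∤q = 0<r<d⇒d∤r+t*d (2 ℕ.+ t ℕ.* 4) (s≤s (s≤s z≤n)) ∘ subst (2 ∣_) (trans q≡5+t*8 (5+t*8≡1+[2+t*4]*2 t))
    where
    5+t*8≡1+[2+t*4]*2 : ∀ t → 5 ℕ.+ t ℕ.* 8 ≡ 1 ℕ.+ (2 ℕ.+ t ℕ.* 4) ℕ.* 2
    5+t*8≡1+[2+t*4]*2 = solve-∀

  q≡5[8]⇒2∣s×4∤s : ∀ {s} → suc (s ℕ.+ s) ≡ q → 2 ∣ s × 4 ∤ s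
  q≡5[8]⇒2∣s×4∤s {s} 1+2s≡q =
    divides (1 ℕ.+ t ℕ.* 2) (trans s≡2+t*4 (2+t*4≡[1+t*2]*2 t)) ,
    0<r<d⇒d∤r+t*d t (s≤s (s≤s (s≤s z≤n))) ∘ subst (4 ∣_) s≡2+t*4
    where
    s*2≡s+s : ∀ s → s ℕ.* 2 ≡ s ℕ.+ s
    s*2≡s+s = solve-∀
    5+t*8≡1+[2+t*4]*2 : ∀ t → 5 ℕ.+ t ℕ.* 8 ≡ suc ((2 ℕ.+ t ℕ.* 4) ℕ.* 2)
    5+t*8≡1+[2+t*4]*2 = solve-∀
    2+t*4≡[1+t*2]*2 : ∀ t → 2 ℕ.+ t ℕ.* 4 ≡ (1 ℕ.+ t ℕ.* 2) ℕ.* 2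
    2+t*4≡[1+t*2]*2 = solve-∀
    s≡2+t*4 : s ≡ 2 ℕ.+ t ℕ.* 4
    s≡2+t*4 = ℕ.*-cancelʳ-≡ s _ 2 (ℕ.suc-injective
      (trans (cong suc (s*2≡s+s s)) (trans 1+2s≡q (trans q≡5+t*8 (5+t*8≡1+[2+t*4]*2 t)))))

theorem5p7 : (q : ℕ) → q % 8 ≡ 5 → (𝔽 : FiniteField q) →
    let open FiniteField 𝔽
        open Graph 𝔽
    in (p : F × F) → IsVertex p →
         (∀ y → Connected p y → y ≡ p)
         ⊎ ∃[ m ] Σ (Label m → F × F) λ L →
             Injective _≡_ _≡_ L
             × (∀ y → Connected p y ⇔ (∃[ l ] (L l ≡ y)))
             × (∀ l l′ → Edge (L l) (L l′) ⇔ ModelEdge m l l′)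
theorem5p7 q q%8≡5 𝔽 p = isolated⊎Component
  where
  open FiniteField 𝔽 using (F; _*_; -_; 0#; 1#)
  open Graph 𝔽 using (2#; IsSquare)
  open FiniteFieldProperties 𝔽

  2≢0 : ¬ 2# ≡ 0#
  2≢0 = q≡5[8]⇒2∤q q%8≡5 ∘ 2#≡0⇒2∣q

  open OddCharacteristic 2≢0

  2∣|squares|×4∤|squares| : 2 ∣ length squares × 4 ∤ length squares
  2∣|squares|×4∤|squares| = q≡5[8]⇒2∣s×4∤s q%8≡5 (trans (cong suc length-squares) suc-length-units)

  √-1 : ∃ λ i → i * i ≡ - 1#
  √-1 = even-squares⇒-1-square (proj₁ 2∣|squares|×4∤|squares|)

  i-nonsquare : ¬ IsSquare (proj₁ √-1)
  i-nonsquare = proj₂ 2∣|squares|×4∤|squares| ∘ square-i⇒4∣|squares| (proj₂ √-1)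

  open JGraph 𝔽 2≢0 (proj₂ √-1) i-nonsquare
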